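{- Let $q$ be an odd prime power and let $a,b\in\mathbb{F}_q^*$. Write \[ D:=\{x\in\mathbb{F}_q : \chi(x)=\chi(a)\ \text{and}\ \chi(x+1)=\chi(b)\}. \] Let $k$ be an integer not divisible by $(q-1)/2$, and let $\ell$ and $\varepsilon$ be the unique integers such that $k\equiv \varepsilon\ell \pmod{q-1}$, $\varepsilon\in\{1,-1\}$, and $0<\ell<(q-1)/2$. Then, in $\mathbb{F}_q$, \[ \sum_{x\in D} x^k = \frac{1+\chi(-a)+2^{ -\ell}\cdot\chi(c)\cdot\sum_{i=0}^{\lfloor \ell/2\rfloor} 4^{ -i}\binom{\ell}{2i}\binom{2i}{i}}{4\cdot(-1)^{\ell+1}}, \] where $c:=ab$ if $\varepsilon=1$ and $c:=b$ if $\varepsilon=-1$. In particular, if $q>3$ then \[ \sum_{x\in D} x = \frac{1+\chi(-a)}{4}+\frac{\chi(ab)}{8}, \] and if $q>5$ then \[ \sum_{x\in D} x^2 = \frac{ -1-\chi(-a)}{4}-3\cdot\frac{\chi(ab)}{32}. \]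
   Context: For an odd prime power $q$, $\chi$ denotes the quadratic character on $\mathbb{F}_q$, defined by $\chi(x):=x^{(q-1)/2}\in\mathbb{F}_q$; thus $\chi(x)=1$ if $x$ is a nonzero square, $\chi(x)=-1$ if $x$ is a nonsquare, and $\chi(0)=0$. Integers and rational numbers with denominators prime to the characteristic are interpreted as elements of $\mathbb{F}_q$. -}

module Defs where

open import Level using (0ℓ)
open import Data.Nat as ℕ using (ℕ; zero; suc)
open import Data.Nat.Combinatorics using (_C_)
open import Data.Integer as ℤ using (ℤ; +_; -[1+_])
open import Data.List using (List; []; _∷_; filter; foldr; length; map; upTo)
open import Data.List.Membership.Propositional using (_∈_)
open import Data.List.Relation.Unary.Unique.Propositional using (Unique)
open import Data.Product using (_×_)
open import Relation.Nullary using (¬_; Dec; yes; no)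
open import Relation.Nullary.Decidable using (_×-dec_)
open import Relation.Binary.PropositionalEquality using (_≡_; _≢_)
open import Relation.Binary.Definitions using (DecidableEquality)
import Algebra.Structures

-- A finite field, with propositional equality as its equality.
-- (Any finite field has prime-power order; its order is the length of
-- the duplicate-free complete enumeration 'elements'.)
record FiniteField : Set₁ where
  infixl 7 _*_
  infixl 6 _+_ _-_
  infix  8 -_
  infix  9 _⁻¹
  infixr 8 _^_ _^ᶻ_
  field
    Carrier  : Set
    _+_ _*_  : Carrier → Carrier → Carrier
    -_       : Carrier → Carrier
    0# 1#    : Carrier
    isCommutativeRing : Algebra.Structures.IsCommutativeRing _≡_ _+_ _*_ -_ 0# 1#
    0≢1      : 0# ≢ 1#
    _⁻¹      : Carrier → Carrier
    ⁻¹-inverse : ∀ x → x ≢ 0# → x * (x ⁻¹) ≡ 1#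
    _≟_      : DecidableEquality Carrier
    elements : List Carrier
    elements-unique   : Unique elements
    elements-complete : ∀ x → x ∈ elements

  order : ℕ
  order = length elements

  _-_ : Carrier → Carrier → Carrier
  x - y = x + (- y)

  _^_ : Carrier → ℕ → Carrier
  x ^ zero  = 1#
  x ^ suc n = x * (x ^ n)

  _^ᶻ_ : Carrier → ℤ → Carrier
  x ^ᶻ (+ n)     = x ^ n
  x ^ᶻ -[1+ n ]  = (x ⁻¹) ^ suc n

  fromℕ : ℕ → Carrier
  fromℕ zero    = 0#
  fromℕ (suc n) = 1# + fromℕ n

  fromℤ : ℤ → Carrier
  fromℤ (+ n)    = fromℕ n
  fromℤ -[1+ n ] = - fromℕ (suc n)

  χ : Carrier → Carrier
  χ x = x ^ ((order ℕ.∸ 1) ℕ./ 2)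

  Σ : List Carrier → Carrier
  Σ = foldr _+_ 0#

  D : Carrier → Carrier → List Carrier
  D a b = filter (λ x → (χ x ≟ χ a) ×-dec (χ (x + 1#) ≟ χ b)) elements

  powerSumD : Carrier → Carrier → ℤ → Carrier
  powerSumD a b k = Σ (map (λ x → x ^ᶻ k) (D a b))

  cOf : ℤ → Carrier → Carrier → Carrier
  cOf ε a b with ε ℤ.≟ ℤ.1ℤ
  ... | yes _ = a * b
  ... | no  _ = b

  innerSum : ℕ → Carrier
  innerSum ℓ = Σ (map (λ i → (((fromℕ 4) ⁻¹) ^ i) * fromℕ ((ℓ C (2 ℕ.* i)) ℕ.* ((2 ℕ.* i) C i)))
                      (upTo (ℓ ℕ./ 2 ℕ.+ 1)))

  rhs : Carrier → Carrier → ℤ → ℕ → Carrier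
  rhs a b ε ℓ =
    (1# + χ (- a) + (((fromℕ 2) ⁻¹) ^ ℓ) * χ (cOf ε a b) * innerSum ℓ)
    * ((fromℕ 4 * ((- 1#) ^ (ℓ ℕ.+ 1))) ⁻¹)

{-# OPTIONS --safe #-}
module Submission where

-- Write q - 1 = 2h, so that χ x = x ^ h, and replace x ^ k by x ^ ℓ or x ^ (2h - ℓ). Off {0, -1}
-- the indicator of D is (1 + χ a χ x)(1 + χ b χ (x + 1)) / 4, so expanding (x + 1) ^ h binomially
-- turns Σ_D x^k into a combination of power sums Σₓ x^m. These vanish for 0 ≤ m < 2(q - 1)
-- except at m = q - 1, where the sum is -1. Exactly one binomial term survives, which leaves
-- Σ_D x^k = -χ(c) C(h, ℓ)/4 minus the contribution (-1)^ℓ (1 + χ(-a))/4 of x = -1.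
-- It remains to evaluate C(h, ℓ) in the field. As h ≡ -½ there, C(h, ℓ) = (-¼)^ℓ C(2ℓ, ℓ), and
-- C(2ℓ, ℓ) = ∑ᵢ C(ℓ, 2i) 2^(ℓ-2i) C(2i, i). Since the characteristic may be smaller than ℓ, both
-- identities are obtained inside the field, by evaluating suitable sums Σₓ x^a f(x) in two ways.

open import Defs
open import Level using (0ℓ)
open import Algebra.Bundles using (CommutativeRing)
open import Algebra.Structures using (IsCommutativeRing)
open import Algebra.Solver.Ring.AlmostCommutativeRing
  using (_-Raw-AlmostCommutative⟶_; fromCommutativeRing)
open import Data.Bool using (true; false; if_then_else_)
open import Data.Empty using (⊥-elim)
open import Data.Integer as ℤ using (ℤ; -[1+_])
open import Data.Integer.Divisibility using (_∣_)
open import Data.Maybe using (Maybe; just; nothing)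
import Data.Integer.Properties as ℤP
import Data.Integer.Divisibility.Signed as SD
open import Data.Integer.Solver using () renaming (module +-*-Solver to ℤSolver)
open import Data.List using (List; []; _∷_; map; foldr; filter; length; applyUpTo)
import Data.List.Properties as List
open import Data.List.Membership.Propositional using (_∈_; find)
open import Data.List.Membership.Propositional.Properties using (∈-map⁺; ∈-map⁻; ∈-filter⁺; ∈-filter⁻)
open import Data.List.Relation.Unary.Any using (here; there)
open import Data.List.Relation.Unary.All as All using (All; []; _∷_)
open import Data.List.Relation.Unary.All.Properties using (¬All⇒Any¬)
open import Data.List.Relation.Unary.AllPairs using ([]; _∷_)
open import Data.List.Relation.Unary.Unique.Propositional using (Unique)
import Data.List.Relation.Unary.Unique.Propositional.Properties as Unique
open import Data.List.Relation.Binary.Permutation.Propositional using (_↭_; ↭⇒↭ₛ)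
import Data.List.Relation.Binary.Permutation.Propositional.Properties as Perm
import Data.List.Relation.Binary.Permutation.Setoid.Properties as PermSetoid
open import Data.List.Relation.Binary.BagAndSetEquality using (∼bag⇒↭)
open import Data.List.Membership.Propositional.Properties.WithK using (unique∧set⇒bag)
open import Data.Nat as ℕ using (ℕ; zero; suc; _≤_; _<_; z≤n; s≤s)
import Data.Nat.Properties as ℕP
open import Data.Nat.Solver using () renaming (module +-*-Solver to ℕSolver)
import Data.Nat.DivMod as ℕD
import Data.Nat.Divisibility as ℕDiv
open import Data.Nat.Combinatorics using (_C_; k>n⇒nCk≡0; nCn≡1)
open import Data.Nat.Induction using (<-rec)
open import Data.Fin using (toℕ)
open import Data.Product using (_×_; _,_; proj₂; ∃)
open import Data.Sign as Sign using (Sign)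
open import Data.Sum using (_⊎_; inj₁; inj₂)
open import Function using (_∘_)
open import Function.Bundles using (mk⇔)
open import Relation.Nullary using (¬_; Dec; yes; no; does)
open import Relation.Nullary.Decidable using (¬?; _×-dec_)
open import Relation.Unary using (Pred; Decidable)
open import Relation.Binary.Definitions using (tri<; tri≈; tri>)
open import Relation.Binary.PropositionalEquality

m<⌊i/2⌋+1⇒2m≤i : ∀ i m → m < i ℕ./ 2 ℕ.+ 1 → 2 ℕ.* m ≤ i
m<⌊i/2⌋+1⇒2m≤i i m m<i/2+1 = begin
  2 ℕ.* m        ≡⟨ ℕP.*-comm 2 m ⟩
  m ℕ.* 2        ≤⟨ ℕP.*-monoˡ-≤ 2 (ℕP.≤-pred (subst (m <_) (ℕP.+-comm (i ℕ./ 2) 1) m<i/2+1)) ⟩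
  i ℕ./ 2 ℕ.* 2  ≤⟨ ℕD.m/n*n≤m i 2 ⟩
  i              ∎
  where open ℕP.≤-Reasoning


m<⌊i/2⌋+1⇒m<i : ∀ i m → 1 ≤ i → m < i ℕ./ 2 ℕ.+ 1 → m < i
m<⌊i/2⌋+1⇒m<i i zero      1≤i _     = 1≤i
m<⌊i/2⌋+1⇒m<i i m@(suc _) _   m<N = ℕP.<-≤-trans (ℕP.m<m+n m (s≤s z≤n))
  (subst (_≤ i) (cong (m ℕ.+_) (ℕP.+-identityʳ m)) (m<⌊i/2⌋+1⇒2m≤i i m m<N))

[n∸j]+k<n+n : ∀ {n j k} → j < n → k ≤ 2 ℕ.* j → n ℕ.∸ j ℕ.+ k < n ℕ.+ n
[n∸j]+k<n+n {n} {j} {k} j<n k≤2j = begin-strict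
  n ℕ.∸ j ℕ.+ k              ≤⟨ ℕP.+-monoʳ-≤ (n ℕ.∸ j) k≤2j ⟩
  n ℕ.∸ j ℕ.+ (j ℕ.+ (j ℕ.+ 0)) ≡⟨ cong (λ t → n ℕ.∸ j ℕ.+ (j ℕ.+ t)) (ℕP.+-identityʳ j) ⟩
  n ℕ.∸ j ℕ.+ (j ℕ.+ j)      ≡⟨ ℕP.+-assoc (n ℕ.∸ j) j j ⟨
  n ℕ.∸ j ℕ.+ j ℕ.+ j        ≡⟨ cong (ℕ._+ j) (ℕP.m∸n+n≡m (ℕP.<⇒≤ j<n)) ⟩
  n ℕ.+ j                    <⟨ ℕP.+-monoʳ-< n j<n ⟩
  n ℕ.+ n                    ∎
  where open ℕP.≤-Reasoning

[n∸j]+k≡n⇒k≡j : ∀ {n j k} → j ≤ n → n ℕ.∸ j ℕ.+ k ≡ n → k ≡ j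
[n∸j]+k≡n⇒k≡j {n} {j} {k} j≤n eq = ℕP.+-cancelˡ-≡ (n ℕ.∸ j) k j (trans eq (sym (ℕP.m∸n+n≡m j≤n)))

ℓ+h+s<4h : ∀ {ℓ h s} → ℓ < h → s ≤ h → ℓ ℕ.+ h ℕ.+ s < (h ℕ.+ h) ℕ.+ (h ℕ.+ h)
ℓ+h+s<4h {ℓ} {h} ℓ<h s≤h =
  ℕP.<-≤-trans (ℕP.+-mono-<-≤ (ℕP.+-monoˡ-< h ℓ<h) s≤h) (ℕP.+-monoʳ-≤ (h ℕ.+ h) (ℕP.m≤m+n h h))

ℓ+h+s≡h+h⇒s≡h∸ℓ : ∀ {ℓ h s} → ℓ ℕ.+ h ℕ.+ s ≡ h ℕ.+ h → s ≡ h ℕ.∸ ℓ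
ℓ+h+s≡h+h⇒s≡h∸ℓ {ℓ} {h} {s} eq = trans (sym (ℕP.m+n∸m≡n ℓ s)) (cong (ℕ._∸ ℓ) (ℕP.+-cancelʳ-≡ h (ℓ ℕ.+ s) h (begin
  ℓ ℕ.+ s ℕ.+ h    ≡⟨ ℕP.+-assoc ℓ s h ⟩
  ℓ ℕ.+ (s ℕ.+ h)  ≡⟨ cong (ℓ ℕ.+_) (ℕP.+-comm s h) ⟩
  ℓ ℕ.+ (h ℕ.+ s)  ≡⟨ ℕP.+-assoc ℓ h s ⟨
  ℓ ℕ.+ h ℕ.+ s    ≡⟨ eq ⟩
  h ℕ.+ h          ∎)))
  where open ≡-Reasoning

ℓ+h+[h∸ℓ]≡h+h : ∀ {ℓ h} → ℓ ≤ h → ℓ ℕ.+ h ℕ.+ (h ℕ.∸ ℓ) ≡ h ℕ.+ h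
ℓ+h+[h∸ℓ]≡h+h {ℓ} {h} ℓ≤h = begin
  ℓ ℕ.+ h ℕ.+ (h ℕ.∸ ℓ)    ≡⟨ cong (ℕ._+ (h ℕ.∸ ℓ)) (ℕP.+-comm ℓ h) ⟩
  h ℕ.+ ℓ ℕ.+ (h ℕ.∸ ℓ)    ≡⟨ ℕP.+-assoc h ℓ (h ℕ.∸ ℓ) ⟩
  h ℕ.+ (ℓ ℕ.+ (h ℕ.∸ ℓ))  ≡⟨ cong (h ℕ.+_) (ℕP.m+[n∸m]≡n ℓ≤h) ⟩
  h ℕ.+ h                  ∎
  where open ≡-Reasoning

j+2t<4h : ∀ {j h t} → j < h → t ≤ h → j ℕ.+ 2 ℕ.* t < (h ℕ.+ h) ℕ.+ (h ℕ.+ h)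
j+2t<4h {j} {h} {t} j<h t≤h = begin-strict
  j ℕ.+ 2 ℕ.* t              <⟨ ℕP.+-mono-<-≤ j<h (ℕP.*-monoʳ-≤ 2 t≤h) ⟩
  h ℕ.+ 2 ℕ.* h              ≤⟨ ℕP.+-monoˡ-≤ (2 ℕ.* h) (ℕP.m≤m+n h h) ⟩
  (h ℕ.+ h) ℕ.+ 2 ℕ.* h      ≡⟨ cong (λ t → (h ℕ.+ h) ℕ.+ (h ℕ.+ t)) (ℕP.+-identityʳ h) ⟩
  (h ℕ.+ h) ℕ.+ (h ℕ.+ h)    ∎
  where open ℕP.≤-Reasoning

2i+2t≡h+h⇒t≡h∸i : ∀ {i t h} → 2 ℕ.* i ℕ.+ 2 ℕ.* t ≡ h ℕ.+ h → t ≡ h ℕ.∸ i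
2i+2t≡h+h⇒t≡h∸i {i} {t} {h} eq = trans (sym (ℕP.m+n∸m≡n i t)) (cong (ℕ._∸ i) (ℕP.*-cancelˡ-≡ (i ℕ.+ t) h 2
  (trans (ℕP.*-distribˡ-+ 2 i t) (trans eq (cong (h ℕ.+_) (sym (ℕP.+-identityʳ h)))))))

2i+2[h∸i]≡h+h : ∀ {i h} → i ≤ h → 2 ℕ.* i ℕ.+ 2 ℕ.* (h ℕ.∸ i) ≡ h ℕ.+ h
2i+2[h∸i]≡h+h {i} {h} i≤h = trans (sym (ℕP.*-distribˡ-+ 2 i (h ℕ.∸ i)))
  (trans (cong (2 ℕ.*_) (ℕP.m+[n∸m]≡n i≤h)) (cong (h ℕ.+_) (ℕP.+-identityʳ h)))

1+2i+2t≢h+h : ∀ i t h → suc (2 ℕ.* i) ℕ.+ 2 ℕ.* t ≢ h ℕ.+ h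
1+2i+2t≢h+h i t h eq = ℕP.even≢odd h (i ℕ.+ t) (begin
  2 ℕ.* h                    ≡⟨ cong (h ℕ.+_) (ℕP.+-identityʳ h) ⟩
  h ℕ.+ h                    ≡⟨ eq ⟨
  suc (2 ℕ.* i ℕ.+ 2 ℕ.* t)  ≡⟨ cong suc (ℕP.*-distribˡ-+ 2 i t) ⟨
  suc (2 ℕ.* (i ℕ.+ t))      ∎)
  where open ≡-Reasoning

h+e+[h∸j]<4h : ∀ {h e j} → e < h → h ℕ.+ e ℕ.+ (h ℕ.∸ j) < (h ℕ.+ h) ℕ.+ (h ℕ.+ h)
h+e+[h∸j]<4h {h} {e} {j} e<h = begin-strict
  h ℕ.+ e ℕ.+ (h ℕ.∸ j)    ≤⟨ ℕP.+-monoʳ-≤ (h ℕ.+ e) (ℕP.m∸n≤m h j) ⟩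
  h ℕ.+ e ℕ.+ h            ≡⟨ ℕSolver.solve 2 (λ h e → h :+ e :+ h := (h :+ h) :+ e) refl h e ⟩
  (h ℕ.+ h) ℕ.+ e          <⟨ ℕP.+-monoʳ-< (h ℕ.+ h) (ℕP.<-≤-trans e<h (ℕP.m≤m+n h h)) ⟩
  (h ℕ.+ h) ℕ.+ (h ℕ.+ h)  ∎
  where open ℕP.≤-Reasoning; open ℕSolver

h+e+[h∸j]≡h+h⇒j≡e : ∀ {h e j} → j ≤ h → e ≤ h → h ℕ.+ e ℕ.+ (h ℕ.∸ j) ≡ h ℕ.+ h → j ≡ e
h+e+[h∸j]≡h+h⇒j≡e {h} {e} {j} j≤h e≤h eq = begin
  j                  ≡⟨ ℕP.m∸[m∸n]≡n j≤h ⟨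
  h ℕ.∸ (h ℕ.∸ j)    ≡⟨ cong (h ℕ.∸_) h∸j≡h∸e ⟩
  h ℕ.∸ (h ℕ.∸ e)    ≡⟨ ℕP.m∸[m∸n]≡n e≤h ⟩
  e                  ∎
  where
  open ≡-Reasoning
  h∸j≡h∸e : h ℕ.∸ j ≡ h ℕ.∸ e
  h∸j≡h∸e = trans (sym (ℕP.m+n∸m≡n e (h ℕ.∸ j)))
    (cong (ℕ._∸ e) (ℕP.+-cancelˡ-≡ h (e ℕ.+ (h ℕ.∸ j)) h (trans (sym (ℕP.+-assoc h e (h ℕ.∸ j))) eq)))

h+e+[h∸e]≡h+h : ∀ {h e} → e ≤ h → h ℕ.+ e ℕ.+ (h ℕ.∸ e) ≡ h ℕ.+ h
h+e+[h∸e]≡h+h {h} {e} e≤h = trans (ℕP.+-assoc h e (h ℕ.∸ e)) (cong (h ℕ.+_) (ℕP.m+[n∸m]≡n e≤h))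

h+h<h+e+h+j : ∀ {h e j} → 1 ≤ e → h ℕ.+ h < h ℕ.+ e ℕ.+ h ℕ.+ j
h+h<h+e+h+j {h} {e} {j} 1≤e = subst (h ℕ.+ h <_) (ℕSolver.solve 3 (λ h e j → (h :+ h) :+ (e :+ j) := h :+ e :+ h :+ j) refl h e j)
  (ℕP.m<m+n (h ℕ.+ h) (ℕP.≤-trans 1≤e (ℕP.m≤m+n e j)))
  where open ℕSolver

h+e+h+j<4h : ∀ {h e j} → e < h → j ≤ h → h ℕ.+ e ℕ.+ h ℕ.+ j < (h ℕ.+ h) ℕ.+ (h ℕ.+ h)
h+e+h+j<4h {h} {e} {j} e<h j≤h = subst (_< (h ℕ.+ h) ℕ.+ (h ℕ.+ h)) (ℕSolver.solve 3 (λ h e j → (h :+ h) :+ (e :+ j) := h :+ e :+ h :+ j) refl h e j)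
  (ℕP.+-monoʳ-< (h ℕ.+ h) (ℕP.+-mono-<-≤ e<h j≤h))
  where open ℕSolver

m+m<h+h⇒m<h : ∀ {m h} → m ℕ.+ m < h ℕ.+ h → m < h
m+m<h+h⇒m<h m+m<h+h = ℕP.≰⇒> (λ h≤m → ℕP.<⇒≱ m+m<h+h (ℕP.+-mono-≤ h≤m h≤m))

module _ (F : FiniteField) where
  open FiniteField F
  open IsCommutativeRing isCommutativeRing
    using (+-assoc; +-comm; +-identityˡ; +-identityʳ; -‿inverseˡ; -‿inverseʳ;
           *-assoc; *-comm; *-identityˡ; *-identityʳ; distribˡ; distribʳ; zeroˡ; zeroʳ;
           +-isCommutativeMonoid; *-isCommutativeMonoid)
  open ≡-Reasoning

  commutativeRing : CommutativeRing 0ℓ 0ℓ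
  commutativeRing = record { isCommutativeRing = isCommutativeRing }

  open import Algebra.Properties.Ring (CommutativeRing.ring commutativeRing)
    using (-0#≈0#; -‿involutive; -‿+-comm; -‿distribˡ-*; -‿distribʳ-*; -‿injective; x∙y⁻¹≈ε⇒x≈y; x≈y⇒x∙y⁻¹≈ε)

  fromℕ-+ : ∀ m n → fromℕ (m ℕ.+ n) ≡ fromℕ m + fromℕ n
  fromℕ-+ zero    n = sym (+-identityˡ _)
  fromℕ-+ (suc m) n = trans (cong (1# +_) (fromℕ-+ m n)) (sym (+-assoc _ _ _))

  fromℕ-* : ∀ m n → fromℕ (m ℕ.* n) ≡ fromℕ m * fromℕ n
  fromℕ-* zero    n = sym (zeroˡ _)
  fromℕ-* (suc m) n = begin
    fromℕ (n ℕ.+ m ℕ.* n)             ≡⟨ fromℕ-+ n (m ℕ.* n) ⟩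
    fromℕ n + fromℕ (m ℕ.* n)         ≡⟨ cong₂ _+_ (sym (*-identityˡ _)) (fromℕ-* m n) ⟩
    1# * fromℕ n + fromℕ m * fromℕ n  ≡⟨ distribʳ _ _ _ ⟨
    (1# + fromℕ m) * fromℕ n          ∎

  fromℤ-⊖ : ∀ m n → fromℤ (m ℤ.⊖ n) ≡ fromℕ m - fromℕ n
  fromℤ-⊖ m       zero    = begin
    fromℤ (m ℤ.⊖ 0)  ≡⟨ cong fromℤ (ℤP.⊖-≥ {m} z≤n) ⟩
    fromℕ m          ≡⟨ +-identityʳ _ ⟨
    fromℕ m + 0#     ≡⟨ cong (fromℕ m +_) -0#≈0# ⟨
    fromℕ m - 0#     ∎
  fromℤ-⊖ zero    (suc n) = sym (+-identityˡ _)
  fromℤ-⊖ (suc m) (suc n) = begin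
    fromℤ (suc m ℤ.⊖ suc n)            ≡⟨ cong fromℤ (ℤP.[1+m]⊖[1+n]≡m⊖n m n) ⟩
    fromℤ (m ℤ.⊖ n)                    ≡⟨ fromℤ-⊖ m n ⟩
    fromℕ m - fromℕ n                  ≡⟨ shift _ _ ⟩
    (1# + fromℕ m) - (1# + fromℕ n)    ∎
    where
    shift : ∀ x y → x - y ≡ (1# + x) - (1# + y)
    shift x y = begin
      x - y                    ≡⟨ +-identityˡ _ ⟨
      0# + (x - y)             ≡⟨ cong (_+ (x - y)) (-‿inverseʳ 1#) ⟨
      (1# - 1#) + (x - y)      ≡⟨ +-assoc _ _ _ ⟩
      1# + (- 1# + (x - y))    ≡⟨ cong (1# +_) (+-assoc _ _ _) ⟨
      1# + ((- 1# + x) - y)    ≡⟨ cong (λ t → 1# + (t - y)) (+-comm _ _) ⟩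
      1# + ((x - 1#) - y)      ≡⟨ cong (1# +_) (+-assoc _ _ _) ⟩
      1# + (x + (- 1# - y))    ≡⟨ cong (λ t → 1# + (x + t)) (-‿+-comm 1# y) ⟩
      1# + (x - (1# + y))      ≡⟨ +-assoc _ _ _ ⟨
      (1# + x) - (1# + y)      ∎

  fromℤ-+ : ∀ i j → fromℤ (i ℤ.+ j) ≡ fromℤ i + fromℤ j
  fromℤ-+ (ℤ.+ m)    (ℤ.+ n)    = fromℕ-+ m n
  fromℤ-+ (ℤ.+ m)    -[1+ n ] = fromℤ-⊖ m (suc n)
  fromℤ-+ -[1+ m ] (ℤ.+ n)    = trans (fromℤ-⊖ n (suc m)) (+-comm _ _)
  fromℤ-+ -[1+ m ] -[1+ n ] = begin
    - fromℕ (suc (suc (m ℕ.+ n)))       ≡⟨ cong -_ (cong (1# +_) (fromℕ-+ (suc m) n)) ⟩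
    - (1# + (fromℕ (suc m) + fromℕ n))  ≡⟨ cong -_ (+-assoc _ _ _) ⟨
    - ((1# + fromℕ (suc m)) + fromℕ n)  ≡⟨ cong (λ t → - (t + fromℕ n)) (+-comm _ _) ⟩
    - ((fromℕ (suc m) + 1#) + fromℕ n)  ≡⟨ cong -_ (+-assoc _ _ _) ⟩
    - (fromℕ (suc m) + fromℕ (suc n))   ≡⟨ -‿+-comm _ _ ⟨
    - fromℕ (suc m) - fromℕ (suc n)     ∎

  fromℤ-neg : ∀ i → fromℤ (ℤ.- i) ≡ - fromℤ i
  fromℤ-neg (ℤ.+ zero)  = sym -0#≈0#
  fromℤ-neg (ℤ.+ suc n) = refl
  fromℤ-neg -[1+ n ]  = sym (-‿involutive _)

  signed : Sign → Carrier → Carrier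
  signed Sign.+ x = x
  signed Sign.- x = - x

  fromℤ-◃ : ∀ s n → fromℤ (s ℤ.◃ n) ≡ signed s (fromℕ n)
  fromℤ-◃ Sign.+ zero    = refl
  fromℤ-◃ Sign.- zero    = sym -0#≈0#
  fromℤ-◃ Sign.+ (suc n) = refl
  fromℤ-◃ Sign.- (suc n) = refl

  signed-* : ∀ s t x y → signed (s Sign.* t) (x * y) ≡ signed s x * signed t y
  signed-* Sign.+ Sign.+ x y = refl
  signed-* Sign.+ Sign.- x y = begin
    - (x * y)  ≡⟨ cong -_ (*-comm x y) ⟩
    - (y * x)  ≡⟨ -‿distribˡ-* y x ⟩
    - y * x    ≡⟨ *-comm _ _ ⟩
    x * - y    ∎
  signed-* Sign.- Sign.+ x y = -‿distribˡ-* x y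
  signed-* Sign.- Sign.- x y = begin
    x * y        ≡⟨ cong (_* y) (-‿involutive x) ⟨
    - - x * y    ≡⟨ -‿distribˡ-* (- x) y ⟨
    - (- x * y)  ≡⟨ signed-* Sign.+ Sign.- (- x) y ⟩
    - x * - y    ∎

  fromℤ-* : ∀ i j → fromℤ (i ℤ.* j) ≡ fromℤ i * fromℤ j
  fromℤ-* i j = begin
    fromℤ (s ℤ.◃ ℤ.∣ i ∣ ℕ.* ℤ.∣ j ∣)                 ≡⟨ fromℤ-◃ s (ℤ.∣ i ∣ ℕ.* ℤ.∣ j ∣) ⟩
    signed s (fromℕ (ℤ.∣ i ∣ ℕ.* ℤ.∣ j ∣))             ≡⟨ cong (signed s) (fromℕ-* ℤ.∣ i ∣ ℤ.∣ j ∣) ⟩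
    signed s (fromℕ ℤ.∣ i ∣ * fromℕ ℤ.∣ j ∣)           ≡⟨ signed-* (ℤ.sign i) (ℤ.sign j) _ _ ⟩
    signed (ℤ.sign i) (fromℕ ℤ.∣ i ∣) * signed (ℤ.sign j) (fromℕ ℤ.∣ j ∣) ≡⟨ cong₂ _*_ (signAbs i) (signAbs j) ⟨
    fromℤ i * fromℤ j                                  ∎
    where
    s = ℤ.sign i Sign.* ℤ.sign j
    signAbs : ∀ i → fromℤ i ≡ signed (ℤ.sign i) (fromℕ ℤ.∣ i ∣)
    signAbs (ℤ.+ n)    = refl
    signAbs -[1+ n ] = refl

  -- Unlike fromℕ it has no trailing + 0#, so the solver constants 1 and 2 denote 1# and 1# + 1# themselves.
  fromℕ′ : ℕ → Carrier
  fromℕ′ zero          = 0#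
  fromℕ′ (suc zero)    = 1#
  fromℕ′ (suc (suc n)) = 1# + fromℕ′ (suc n)

  fromℕ′≡fromℕ : ∀ n → fromℕ′ n ≡ fromℕ n
  fromℕ′≡fromℕ zero          = refl
  fromℕ′≡fromℕ (suc zero)    = sym (+-identityʳ 1#)
  fromℕ′≡fromℕ (suc (suc n)) = cong (1# +_) (fromℕ′≡fromℕ (suc n))

  fromℤ′ : ℤ → Carrier
  fromℤ′ (ℤ.+ n)    = fromℕ′ n
  fromℤ′ -[1+ n ] = - fromℕ′ (suc n)

  fromℤ′≡fromℤ : ∀ i → fromℤ′ i ≡ fromℤ i
  fromℤ′≡fromℤ (ℤ.+ n)    = fromℕ′≡fromℕ n
  fromℤ′≡fromℤ -[1+ n ] = cong -_ (fromℕ′≡fromℕ (suc n))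

  private
    homo₂ : ∀ (f : ℤ → ℤ → ℤ) (g : Carrier → Carrier → Carrier) →
            (∀ i j → fromℤ (f i j) ≡ g (fromℤ i) (fromℤ j)) →
            ∀ i j → fromℤ′ (f i j) ≡ g (fromℤ′ i) (fromℤ′ j)
    homo₂ f g hom i j = trans (fromℤ′≡fromℤ (f i j))
      (trans (hom i j) (sym (cong₂ g (fromℤ′≡fromℤ i) (fromℤ′≡fromℤ j))))

  fromℤ′-morphism : ℤ.+-*-rawRing -Raw-AlmostCommutative⟶ fromCommutativeRing commutativeRing
  fromℤ′-morphism = record
    { ⟦_⟧    = fromℤ′
    ; +-homo = homo₂ ℤ._+_ _+_ fromℤ-+
    ; *-homo = homo₂ ℤ._*_ _*_ fromℤ-*
    ; -‿homo = λ i → trans (fromℤ′≡fromℤ (ℤ.- i)) (trans (fromℤ-neg i) (cong -_ (sym (fromℤ′≡fromℤ i))))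
    ; 0-homo = refl
    ; 1-homo = refl
    }

  private
    ≟-coefficient : ∀ i j → Maybe (fromℤ′ i ≡ fromℤ′ j)
    ≟-coefficient i j with i ℤ.≟ j
    ... | yes refl = just refl
    ... | no _     = nothing

  open import Algebra.Solver.Ring ℤ.+-*-rawRing (fromCommutativeRing commutativeRing)
    fromℤ′-morphism ≟-coefficient public

  1≢0 : 1# ≢ 0#
  1≢0 = 0≢1 ∘ sym

  ⁻¹-inverseˡ : ∀ x → x ≢ 0# → x ⁻¹ * x ≡ 1#
  ⁻¹-inverseˡ x x≢0 = trans (*-comm _ _) (⁻¹-inverse x x≢0)

  *-cancelˡ : ∀ {c x y} → c ≢ 0# → c * x ≡ c * y → x ≡ y
  *-cancelˡ {c} {x} {y} c≢0 cx≡cy = begin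
    x                ≡⟨ *-identityˡ x ⟨
    1# * x           ≡⟨ cong (_* x) (⁻¹-inverseˡ c c≢0) ⟨
    (c ⁻¹ * c) * x   ≡⟨ *-assoc _ _ _ ⟩
    c ⁻¹ * (c * x)   ≡⟨ cong (c ⁻¹ *_) cx≡cy ⟩
    c ⁻¹ * (c * y)   ≡⟨ *-assoc _ _ _ ⟨
    (c ⁻¹ * c) * y   ≡⟨ cong (_* y) (⁻¹-inverseˡ c c≢0) ⟩
    1# * y           ≡⟨ *-identityˡ y ⟩
    y                ∎

  x*y≡0⇒x≡0⊎y≡0 : ∀ x y → x * y ≡ 0# → x ≡ 0# ⊎ y ≡ 0#
  x*y≡0⇒x≡0⊎y≡0 x y xy≡0 with x ≟ 0#
  ... | yes x≡0 = inj₁ x≡0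
  ... | no  x≢0 = inj₂ (*-cancelˡ x≢0 (trans xy≡0 (sym (zeroʳ x))))

  *-nonzero : ∀ {x y} → x ≢ 0# → y ≢ 0# → x * y ≢ 0#
  *-nonzero {x} {y} x≢0 y≢0 xy≡0 with x*y≡0⇒x≡0⊎y≡0 x y xy≡0
  ... | inj₁ x≡0 = x≢0 x≡0
  ... | inj₂ y≡0 = y≢0 y≡0

  ⁻¹-unique : ∀ {x y} → x * y ≡ 1# → x ⁻¹ ≡ y
  ⁻¹-unique {x} {y} xy≡1 = *-cancelˡ x≢0 (trans (⁻¹-inverse x x≢0) (sym xy≡1))
    where
    x≢0 : x ≢ 0#
    x≢0 x≡0 = 1≢0 (trans (sym xy≡1) (trans (cong (_* y) x≡0) (zeroˡ y)))

  ⁻¹-nonzero : ∀ {x} → x ≢ 0# → x ⁻¹ ≢ 0#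
  ⁻¹-nonzero {x} x≢0 x⁻¹≡0 = 1≢0 (trans (sym (⁻¹-inverse x x≢0)) (trans (cong (x *_) x⁻¹≡0) (zeroʳ x)))

  x-y≡0⇒x≡y : ∀ {x y} → x - y ≡ 0# → x ≡ y
  x-y≡0⇒x≡y = x∙y⁻¹≈ε⇒x≈y _ _

  -1≢0 : - 1# ≢ 0#
  -1≢0 -1≡0 = 1≢0 (-‿injective (trans -1≡0 (sym -0#≈0#)))

  -1+1≡0 : - 1# + 1# ≡ 0#
  -1+1≡0 = -‿inverseˡ 1#

  x+1≢0 : ∀ {x} → x ≢ - 1# → x + 1# ≢ 0#
  x+1≢0 {x} x≢-1 x+1≡0 = x≢-1 (begin
    x              ≡⟨ solve 2 (λ x o → x := (x :+ o) :- o) refl x 1# ⟩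
    (x + 1#) - 1#  ≡⟨ cong (_- 1#) x+1≡0 ⟩
    0# - 1#        ≡⟨ +-identityˡ _ ⟩
    - 1#           ∎)

  ^-homo-* : ∀ x m n → x ^ (m ℕ.+ n) ≡ x ^ m * x ^ n
  ^-homo-* x zero    n = sym (*-identityˡ _)
  ^-homo-* x (suc m) n = trans (cong (x *_) (^-homo-* x m n)) (sym (*-assoc _ _ _))

  ^-distrib-* : ∀ x y n → (x * y) ^ n ≡ x ^ n * y ^ n
  ^-distrib-* x y zero    = sym (*-identityˡ 1#)
  ^-distrib-* x y (suc n) = trans (cong ((x * y) *_) (^-distrib-* x y n))
    (solve 4 (λ x y a b → (x :* y) :* (a :* b) := (x :* a) :* (y :* b)) refl x y (x ^ n) (y ^ n))

  ^-assocʳ : ∀ x m n → (x ^ m) ^ n ≡ x ^ (m ℕ.* n)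
  ^-assocʳ x m zero    = cong (x ^_) (sym (ℕP.*-zeroʳ m))
  ^-assocʳ x m (suc n) = begin
    x ^ m * (x ^ m) ^ n     ≡⟨ cong (x ^ m *_) (^-assocʳ x m n) ⟩
    x ^ m * x ^ (m ℕ.* n)   ≡⟨ ^-homo-* x m (m ℕ.* n) ⟨
    x ^ (m ℕ.+ m ℕ.* n)     ≡⟨ cong (x ^_) (ℕP.*-suc m n) ⟨
    x ^ (m ℕ.* suc n)       ∎

  1^n≡1 : ∀ n → 1# ^ n ≡ 1#
  1^n≡1 zero    = refl
  1^n≡1 (suc n) = trans (*-identityˡ _) (1^n≡1 n)

  0^n≡0 : ∀ n → 1 ≤ n → 0# ^ n ≡ 0#
  0^n≡0 (suc n) _ = zeroˡ _

  ^-nonzero : ∀ {x} n → x ≢ 0# → x ^ n ≢ 0#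
  ^-nonzero zero    x≢0 = 1≢0
  ^-nonzero (suc n) x≢0 = *-nonzero x≢0 (^-nonzero n x≢0)

  [-1]^ℓ*[-1]^ℓ≡1 : ∀ ℓ → (- 1#) ^ ℓ * (- 1#) ^ ℓ ≡ 1#
  [-1]^ℓ*[-1]^ℓ≡1 ℓ = trans (sym (^-distrib-* (- 1#) (- 1#) ℓ))
    (trans (cong (_^ ℓ) (solve 0 (:- con (ℤ.+ 1) :* :- con (ℤ.+ 1) := con (ℤ.+ 1)) refl)) (1^n≡1 ℓ))

  Σ-map-+ : ∀ {A : Set} (f g : A → Carrier) xs →
            Σ (map (λ x → f x + g x) xs) ≡ Σ (map f xs) + Σ (map g xs)
  Σ-map-+ f g []       = sym (+-identityˡ 0#)
  Σ-map-+ f g (x ∷ xs) = trans (cong ((f x + g x) +_) (Σ-map-+ f g xs))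
    (solve 4 (λ a b c d → (a :+ b) :+ (c :+ d) := (a :+ c) :+ (b :+ d)) refl _ _ _ _)

  Σ-map-* : ∀ {A : Set} c (f : A → Carrier) xs → Σ (map (λ x → c * f x) xs) ≡ c * Σ (map f xs)
  Σ-map-* c f []       = sym (zeroʳ c)
  Σ-map-* c f (x ∷ xs) = trans (cong (c * f x +_) (Σ-map-* c f xs)) (sym (distribˡ _ _ _))

  Σ-map-neg : ∀ {A : Set} (f : A → Carrier) xs → Σ (map (λ x → - f x) xs) ≡ - Σ (map f xs)
  Σ-map-neg f []       = sym -0#≈0#
  Σ-map-neg f (x ∷ xs) = trans (cong (- f x +_) (Σ-map-neg f xs)) (-‿+-comm _ _)

  Σ-map-cong : ∀ {A : Set} {f g : A → Carrier} xs → (∀ x → f x ≡ g x) → Σ (map f xs) ≡ Σ (map g xs)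
  Σ-map-cong xs f≗g = cong Σ (List.map-cong f≗g xs)

  Σ-map-1 : ∀ {A : Set} (xs : List A) → Σ (map (λ _ → 1#) xs) ≡ fromℕ (length xs)
  Σ-map-1 []       = refl
  Σ-map-1 (x ∷ xs) = cong (1# +_) (Σ-map-1 xs)

  Σ-map-0 : ∀ {A : Set} (f : A → Carrier) xs → All (λ x → f x ≡ 0#) xs → Σ (map f xs) ≡ 0#
  Σ-map-0 f []       []          = refl
  Σ-map-0 f (x ∷ xs) (fx≡0 ∷ ps) = trans (cong₂ _+_ fx≡0 (Σ-map-0 f xs ps)) (+-identityˡ 0#)

  Σ-map-↭ : ∀ {A : Set} (f : A → Carrier) {xs ys} → xs ↭ ys → Σ (map f xs) ≡ Σ (map f ys)
  Σ-map-↭ f p = PermSetoid.foldr-commMonoid (setoid Carrier) +-isCommutativeMonoid (↭⇒↭ₛ (Perm.map⁺ f p))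

  select : ∀ {ℓ} {Q : Set ℓ} → Dec Q → Carrier → Carrier
  select Q? v = if does Q? then v else 0#

  Σ-map-filter : ∀ {ℓ} {A : Set} {P : Pred A ℓ} (P? : Decidable P) (f : A → Carrier) xs →
                 Σ (map f (filter P? xs)) ≡ Σ (map (λ x → select (P? x) (f x)) xs)
  Σ-map-filter P? f []       = refl
  Σ-map-filter P? f (x ∷ xs) with does (P? x)
  ... | true  = cong (f x +_) (Σ-map-filter P? f xs)
  ... | false = trans (Σ-map-filter P? f xs) (sym (+-identityˡ _))

  Σ-map-supported : ∀ (f : Carrier → Carrier) z xs → Unique xs → z ∈ xs → (∀ x → x ≢ z → f x ≡ 0#) →
                    Σ (map f xs) ≡ f z
  Σ-map-supported f z (x ∷ xs) (x∉xs ∷ _) (here refl) f≡0 = begin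
    f x + Σ (map f xs)  ≡⟨ cong (f x +_) (Σ-map-0 f xs (All.map (λ x≢y → f≡0 _ (x≢y ∘ sym)) x∉xs)) ⟩
    f x + 0#            ≡⟨ +-identityʳ _ ⟩
    f x                 ∎
  Σ-map-supported f z (x ∷ xs) (x∉xs ∷ u) (there z∈xs) f≡0 = begin
    f x + Σ (map f xs)  ≡⟨ cong₂ _+_ (f≡0 x (All.lookup x∉xs z∈xs)) (Σ-map-supported f z xs u z∈xs f≡0) ⟩
    0# + f z            ≡⟨ +-identityˡ _ ⟩
    f z                 ∎

  ↭-of-same-elements : ∀ {xs ys : List Carrier} → Unique xs → Unique ys →
                       (∀ {x} → x ∈ xs → x ∈ ys) → (∀ {x} → x ∈ ys → x ∈ xs) → xs ↭ ys
  ↭-of-same-elements uxs uys xs⊆ys ys⊆xs = ∼bag⇒↭ (unique∧set⇒bag uxs uys (mk⇔ xs⊆ys ys⊆xs))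

  Σ-reindex : ∀ (f σ τ : Carrier → Carrier) → (∀ x → τ (σ x) ≡ x) → (∀ y → σ (τ y) ≡ y) →
              Σ (map (f ∘ σ) elements) ≡ Σ (map f elements)
  Σ-reindex f σ τ τσ≗id στ≗id = begin
    Σ (map (f ∘ σ) elements)    ≡⟨ cong Σ (List.map-∘ elements) ⟩
    Σ (map f (map σ elements))  ≡⟨ Σ-map-↭ f σ-permutes ⟩
    Σ (map f elements)          ∎
    where
    σ-injective : ∀ {x y} → σ x ≡ σ y → x ≡ y
    σ-injective {x} {y} σx≡σy = trans (sym (τσ≗id x)) (trans (cong τ σx≡σy) (τσ≗id y))
    σ-permutes : map σ elements ↭ elements
    σ-permutes = ↭-of-same-elements (Unique.map⁺ σ-injective elements-unique) elements-unique
      (λ {y} _ → elements-complete y)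
      (λ {y} _ → subst (_∈ map σ elements) (στ≗id y) (∈-map⁺ σ (elements-complete (τ y))))

  characteristic-divides-order : fromℕ order ≡ 0#
  characteristic-divides-order = begin
    fromℕ order                            ≡⟨ +-identityˡ _ ⟨
    0# + fromℕ order                       ≡⟨ cong (_+ fromℕ order) (-‿inverseˡ S) ⟨
    (- S + S) + fromℕ order                ≡⟨ +-assoc _ _ _ ⟩
    - S + (S + fromℕ order)                ≡⟨ cong (λ t → - S + (S + t)) (Σ-map-1 elements) ⟨
    - S + (S + Σ (map (λ _ → 1#) elements)) ≡⟨ cong (- S +_) (Σ-map-+ (λ x → x) (λ _ → 1#) elements) ⟨
    - S + Σ (map (λ x → x + 1#) elements)  ≡⟨ cong (- S +_) (Σ-reindex (λ x → x) (_+ 1#) (_- 1#) +1-1 -1+1) ⟩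
    - S + S                                ≡⟨ -‿inverseˡ S ⟩
    0#                                     ∎
    where
    S = Σ (map (λ x → x) elements)
    +1-1 : ∀ x → (x + 1#) - 1# ≡ x
    +1-1 x = solve 2 (λ x o → (x :+ o) :- o := x) refl x 1#
    -1+1 : ∀ x → (x - 1#) + 1# ≡ x
    -1+1 x = solve 2 (λ x o → (x :- o) :+ o := x) refl x 1#

  Σ-map-except : ∀ (f g : Carrier → Carrier) z → (∀ x → x ≢ z → g x ≡ f x) → g z ≡ 0# →
                 Σ (map g elements) ≡ Σ (map f elements) - f z
  Σ-map-except f g z g≡f gz≡0 = begin
    Σ (map g elements)                              ≡⟨ Σ-map-cong elements (λ x → solve 2 (λ g f → g := f :+ (:- (f :- g))) refl (g x) (f x)) ⟩
    Σ (map (λ x → f x + - (f x - g x)) elements)    ≡⟨ Σ-map-+ f (λ x → - (f x - g x)) elements ⟩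
    Σ (map f elements) + Σ (map (λ x → - (f x - g x)) elements)
                                                    ≡⟨ cong (Σ (map f elements) +_) (Σ-map-neg (λ x → f x - g x) elements) ⟩
    Σ (map f elements) - Σ (map (λ x → f x - g x) elements)
                                                    ≡⟨ cong (λ t → Σ (map f elements) - t) (Σ-map-supported (λ x → f x - g x) z elements
                                                         elements-unique (elements-complete z) (λ x x≢z → x≈y⇒x∙y⁻¹≈ε (sym (g≡f x x≢z)))) ⟩
    Σ (map f elements) - (f z - g z)                ≡⟨ cong (λ t → Σ (map f elements) - (f z - t)) gz≡0 ⟩
    Σ (map f elements) - (f z - 0#)                 ≡⟨ cong (λ t → Σ (map f elements) - t) (trans (cong (f z +_) -0#≈0#) (+-identityʳ _)) ⟩
    Σ (map f elements) - f z                        ∎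

  -- Fermat's little theorem and power sums

  nonzeros : List Carrier
  nonzeros = filter (λ x → ¬? (x ≟ 0#)) elements

  q-1 : ℕ
  q-1 = length nonzeros

  nonzeros-unique : Unique nonzeros
  nonzeros-unique = Unique.filter⁺ (λ x → ¬? (x ≟ 0#)) elements-unique

  nonzeros-complete : ∀ x → x ≢ 0# → x ∈ nonzeros
  nonzeros-complete x x≢0 = ∈-filter⁺ (λ x → ¬? (x ≟ 0#)) (elements-complete x) x≢0

  nonzeros-nonzero : ∀ {x} → x ∈ nonzeros → x ≢ 0#
  nonzeros-nonzero x∈ = proj₂ (∈-filter⁻ (λ x → ¬? (x ≟ 0#)) {xs = elements} x∈)

  elements↭0∷nonzeros : elements ↭ 0# ∷ nonzeros
  elements↭0∷nonzeros = ↭-of-same-elements elements-unique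
    (All.tabulate (λ x∈ 0≡x → nonzeros-nonzero x∈ (sym 0≡x)) ∷ nonzeros-unique)
    (λ {x} _ → 0-or-nonzero x) (λ {x} _ → elements-complete x)
    where
    0-or-nonzero : ∀ x → x ∈ 0# ∷ nonzeros
    0-or-nonzero x with x ≟ 0#
    ... | yes x≡0 = here x≡0
    ... | no  x≢0 = there (nonzeros-complete x x≢0)

  order≡1+q-1 : order ≡ suc q-1
  order≡1+q-1 = Perm.↭-length elements↭0∷nonzeros

  Σ-map-elements : ∀ (f : Carrier → Carrier) → Σ (map f elements) ≡ f 0# + Σ (map f nonzeros)
  Σ-map-elements f = Σ-map-↭ f elements↭0∷nonzeros

  Π : List Carrier → Carrier
  Π = foldr _*_ 1#

  Π-map-* : ∀ a xs → Π (map (a *_) xs) ≡ a ^ length xs * Π xs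
  Π-map-* a []       = sym (*-identityˡ 1#)
  Π-map-* a (x ∷ xs) = trans (cong ((a * x) *_) (Π-map-* a xs))
    (solve 4 (λ a x p q → (a :* x) :* (p :* q) := (a :* p) :* (x :* q)) refl a x (a ^ length xs) (Π xs))

  Π-nonzero : ∀ xs → All (_≢ 0#) xs → Π xs ≢ 0#
  Π-nonzero []       []         = 1≢0
  Π-nonzero (x ∷ xs) (x≢0 ∷ ps) = *-nonzero x≢0 (Π-nonzero xs ps)

  -- Multiplication by a nonzero a permutes the nonzero elements.
  fermat : ∀ a → a ≢ 0# → a ^ q-1 ≡ 1#
  fermat a a≢0 = *-cancelˡ ΠN≢0 (begin
    Π nonzeros * a ^ q-1              ≡⟨ *-comm _ _ ⟩
    a ^ q-1 * Π nonzeros              ≡⟨ Π-map-* a nonzeros ⟨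
    Π (map (a *_) nonzeros)           ≡⟨ PermSetoid.foldr-commMonoid (setoid Carrier) *-isCommutativeMonoid (↭⇒↭ₛ a*-permutes) ⟩
    Π nonzeros                        ≡⟨ *-identityʳ _ ⟨
    Π nonzeros * 1#                   ∎)
    where
    ΠN≢0 : Π nonzeros ≢ 0#
    ΠN≢0 = Π-nonzero nonzeros (All.tabulate nonzeros-nonzero)
    a*a⁻¹* : ∀ y → a * (a ⁻¹ * y) ≡ y
    a*a⁻¹* y = trans (sym (*-assoc _ _ _)) (trans (cong (_* y) (⁻¹-inverse a a≢0)) (*-identityˡ y))
    image⊆ : ∀ {y} → y ∈ map (a *_) nonzeros → y ∈ nonzeros
    image⊆ y∈ with ∈-map⁻ (a *_) y∈
    ... | x , x∈ , refl = nonzeros-complete _ (*-nonzero a≢0 (nonzeros-nonzero x∈))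
    ⊆image : ∀ {y} → y ∈ nonzeros → y ∈ map (a *_) nonzeros
    ⊆image {y} y∈ = subst (_∈ map (a *_) nonzeros) (a*a⁻¹* y)
      (∈-map⁺ (a *_) (nonzeros-complete _ (*-nonzero (⁻¹-nonzero a≢0) (nonzeros-nonzero y∈))))
    a*-permutes : map (a *_) nonzeros ↭ nonzeros
    a*-permutes = ↭-of-same-elements (Unique.map⁺ (*-cancelˡ a≢0) nonzeros-unique) nonzeros-unique image⊆ ⊆image

  -- Polynomials as coefficient lists, lowest degree first.
  eval : List Carrier → Carrier → Carrier
  eval []       x = 0#
  eval (c ∷ cs) x = c + x * eval cs x

  module _ (r : Carrier) where
    divide : List Carrier → List Carrier
    divide []       = []
    divide (d ∷ ds) = eval (d ∷ ds) r ∷ divide ds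

    length-divide : ∀ cs → length (divide cs) ≡ length cs
    length-divide []       = refl
    length-divide (d ∷ ds) = cong suc (length-divide ds)

    eval-divide : ∀ x c cs → eval (c ∷ cs) x - eval (c ∷ cs) r ≡ (x - r) * eval (divide cs) x
    eval-divide x c []       = solve 3 (λ x r c → (c :+ x :* con (ℤ.+ 0)) :- (c :+ r :* con (ℤ.+ 0)) := (x :- r) :* con (ℤ.+ 0)) refl x r c
    eval-divide x c (d ∷ ds) = begin
      (c + x * Fx) - (c + r * Fr)       ≡⟨ solve 5 (λ c x r Fx Fr → (c :+ x :* Fx) :- (c :+ r :* Fr) := x :* (Fx :- Fr) :+ (x :- r) :* Fr) refl c x r Fx Fr ⟩
      x * (Fx - Fr) + (x - r) * Fr      ≡⟨ cong (λ t → x * t + (x - r) * Fr) (eval-divide x d ds) ⟩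
      x * ((x - r) * Q) + (x - r) * Fr  ≡⟨ solve 4 (λ x r Q Fr → x :* ((x :- r) :* Q) :+ (x :- r) :* Fr := (x :- r) :* (Fr :+ x :* Q)) refl x r Q Fr ⟩
      (x - r) * (Fr + x * Q)            ∎
      where
      Fx = eval (d ∷ ds) x
      Fr = eval (d ∷ ds) r
      Q  = eval (divide ds) x

    zero-quotient : ∀ c cs → eval (c ∷ cs) r ≡ 0# → All (_≡ 0#) (divide cs) → All (_≡ 0#) (c ∷ cs)
    zero-quotient c []       root []       = trans (sym (trans (cong (c +_) (zeroʳ r)) (+-identityʳ c))) root ∷ []
    zero-quotient c (d ∷ ds) root (p ∷ ps) = c≡0 ∷ zero-quotient d ds p ps
      where
      c≡0 : c ≡ 0#
      c≡0 = begin
        c                        ≡⟨ +-identityʳ c ⟨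
        c + 0#                   ≡⟨ cong (c +_) (trans (cong (r *_) p) (zeroʳ r)) ⟨
        c + r * eval (d ∷ ds) r  ≡⟨ root ⟩
        0#                       ∎

  roots⇒zero-polynomial : ∀ (f rs : List Carrier) → length f ≤ length rs → Unique rs →
                          All (λ s → eval f s ≡ 0#) rs → All (_≡ 0#) f
  roots⇒zero-polynomial []       rs       _         _             _             = []
  roots⇒zero-polynomial (c ∷ cs) (r ∷ rs) (s≤s len) (r∉rs ∷ urs) (root ∷ roots) =
    zero-quotient r c cs root
      (roots⇒zero-polynomial (divide r cs) rs (subst (_≤ length rs) (sym (length-divide r cs)) len) urs
        (All.zipWith (λ (r≢s , fs≡0) → quotient-root r≢s fs≡0) (r∉rs , roots)))
    where
    quotient-root : ∀ {s} → r ≢ s → eval (c ∷ cs) s ≡ 0# → eval (divide r cs) s ≡ 0#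
    quotient-root {s} r≢s fs≡0 with x*y≡0⇒x≡0⊎y≡0 (s - r) (eval (divide r cs) s) (begin
      (s - r) * eval (divide r cs) s      ≡⟨ eval-divide r s c cs ⟨
      eval (c ∷ cs) s - eval (c ∷ cs) r   ≡⟨ cong₂ _-_ fs≡0 root ⟩
      0# - 0#                             ≡⟨ -‿inverseʳ 0# ⟩
      0#                                  ∎)
    ... | inj₁ s-r≡0 = ⊥-elim (r≢s (sym (x-y≡0⇒x≡y s-r≡0)))
    ... | inj₂ q≡0   = q≡0

  monomial : ℕ → List Carrier
  monomial zero    = 1# ∷ []
  monomial (suc k) = 0# ∷ monomial k

  eval-monomial : ∀ k x → eval (monomial k) x ≡ x ^ k
  eval-monomial zero    x = trans (cong (1# +_) (zeroʳ x)) (+-identityʳ 1#)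
  eval-monomial (suc k) x = trans (+-identityˡ _) (cong (x *_) (eval-monomial k x))

  monomial-nonzero : ∀ k → ¬ All (_≡ 0#) (monomial k)
  monomial-nonzero zero    (1≡0 ∷ []) = 1≢0 1≡0
  monomial-nonzero (suc k) (_ ∷ ps)   = monomial-nonzero k ps

  length-monomial : ∀ k → length (monomial k) ≡ suc k
  length-monomial zero    = refl
  length-monomial (suc k) = cong suc (length-monomial k)

  -- x ^ m - 1 has at most m roots.
  ^≢1-witness : ∀ m → 1 ≤ m → m < q-1 → ∃ λ a → a ≢ 0# × a ^ m ≢ 1#
  ^≢1-witness (suc k) _ m<n with All.all? (λ x → (x ^ suc k) ≟ 1#) nonzeros
  ... | no ¬all = let a , a∈ , a^m≢1 = find (¬All⇒Any¬ (λ x → (x ^ suc k) ≟ 1#) nonzeros ¬all)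
                  in a , nonzeros-nonzero a∈ , a^m≢1
  ... | yes all = ⊥-elim (monomial-nonzero k (tail (roots⇒zero-polynomial (- 1# ∷ monomial k) nonzeros len
                    nonzeros-unique (All.map root all))))
    where
    tail : ∀ {y ys} → All (_≡ 0#) (y ∷ ys) → All (_≡ 0#) ys
    tail (_ ∷ ps) = ps
    len : suc (length (monomial k)) ≤ q-1
    len = subst (λ t → suc t ≤ q-1) (sym (length-monomial k)) m<n
    root : ∀ {x} → x ^ suc k ≡ 1# → eval (- 1# ∷ monomial k) x ≡ 0#
    root {x} x^m≡1 = begin
      - 1# + x * eval (monomial k) x  ≡⟨ cong (λ t → - 1# + x * t) (eval-monomial k x) ⟩
      - 1# + x ^ suc k                ≡⟨ cong (- 1# +_) x^m≡1 ⟩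
      - 1# + 1#                       ≡⟨ -‿inverseˡ 1# ⟩
      0#                              ∎

  1≤q-1 : 1 ≤ q-1
  1≤q-1 with nonzeros | nonzeros-complete 1# 1≢0
  ... | _ ∷ _ | _ = s≤s z≤n

  fromℕ[q-1]≡-1 : fromℕ q-1 ≡ - 1#
  fromℕ[q-1]≡-1 = begin
    fromℕ q-1                 ≡⟨ +-identityˡ _ ⟨
    0# + fromℕ q-1            ≡⟨ cong (_+ fromℕ q-1) (-‿inverseˡ 1#) ⟨
    (- 1# + 1#) + fromℕ q-1   ≡⟨ +-assoc _ _ _ ⟩
    - 1# + fromℕ (suc q-1)    ≡⟨ cong (λ t → - 1# + fromℕ t) order≡1+q-1 ⟨
    - 1# + fromℕ order        ≡⟨ cong (- 1# +_) characteristic-divides-order ⟩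
    - 1# + 0#                 ≡⟨ +-identityʳ _ ⟩
    - 1#                      ∎

  ^-mod-q-1 : ∀ {x} → x ≢ 0# → ∀ m k → x ^ (m ℕ.+ k ℕ.* q-1) ≡ x ^ m
  ^-mod-q-1 {x} x≢0 m k = begin
    x ^ (m ℕ.+ k ℕ.* q-1)     ≡⟨ ^-homo-* x m (k ℕ.* q-1) ⟩
    x ^ m * x ^ (k ℕ.* q-1)   ≡⟨ cong (λ t → x ^ m * x ^ t) (ℕP.*-comm k q-1) ⟩
    x ^ m * x ^ (q-1 ℕ.* k)   ≡⟨ cong (x ^ m *_) (^-assocʳ x q-1 k) ⟨
    x ^ m * (x ^ q-1) ^ k     ≡⟨ cong (λ t → x ^ m * t ^ k) (fermat x x≢0) ⟩
    x ^ m * 1# ^ k            ≡⟨ cong (x ^ m *_) (1^n≡1 k) ⟩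
    x ^ m * 1#                ≡⟨ *-identityʳ _ ⟩
    x ^ m                     ∎

  x⁻¹≡x^[q-2] : ∀ {x} → x ≢ 0# → x ⁻¹ ≡ x ^ (q-1 ℕ.∸ 1)
  x⁻¹≡x^[q-2] {x} x≢0 = ⁻¹-unique (begin
    x * x ^ (q-1 ℕ.∸ 1)   ≡⟨⟩
    x ^ suc (q-1 ℕ.∸ 1)   ≡⟨ cong (x ^_) (ℕP.m+[n∸m]≡n 1≤q-1) ⟩
    x ^ q-1               ≡⟨ fermat x x≢0 ⟩
    1#                    ∎)

  ^-mod-q-1-≤ : ∀ {x} → x ≢ 0# → ∀ {m n} → n ≤ m → q-1 ℕDiv.∣ m ℕ.∸ n → x ^ m ≡ x ^ n
  ^-mod-q-1-≤ {x} x≢0 {m} {n} n≤m (ℕDiv.divides c m∸n≡c*[q-1]) = begin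
    x ^ m                  ≡⟨ cong (x ^_) (ℕP.m+[n∸m]≡n n≤m) ⟨
    x ^ (n ℕ.+ (m ℕ.∸ n))  ≡⟨ cong (λ t → x ^ (n ℕ.+ t)) m∸n≡c*[q-1] ⟩
    x ^ (n ℕ.+ c ℕ.* q-1)  ≡⟨ ^-mod-q-1 x≢0 n c ⟩
    x ^ n                  ∎

  ^ᶻ-mod-q-1 : ∀ {x} → x ≢ 0# → ∀ k m → ℤ.+ q-1 ∣ (k ℤ.- ℤ.+ m) → x ^ᶻ k ≡ x ^ m
  ^ᶻ-mod-q-1 {x} x≢0 (ℤ.+ n) m q-1∣n-m with ℕP.≤-total m n
  ... | inj₁ m≤n = ^-mod-q-1-≤ x≢0 m≤n (subst (q-1 ℕDiv.∣_) (trans (cong ℤ.∣_∣ (ℤP.m-n≡m⊖n n m))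
                     (trans (ℤP.∣m⊖n∣≡∣n⊖m∣ n m) (ℤP.∣⊖∣-≤ m≤n))) q-1∣n-m)
  ... | inj₂ n≤m = sym (^-mod-q-1-≤ x≢0 n≤m (subst (q-1 ℕDiv.∣_) (trans (cong ℤ.∣_∣ (ℤP.m-n≡m⊖n n m))
                     (ℤP.∣⊖∣-≤ n≤m)) q-1∣n-m))
  ^ᶻ-mod-q-1 {x} x≢0 -[1+ n ] m q-1∣k-m = begin
    (x ⁻¹) ^ suc n             ≡⟨ cong (_^ suc n) (x⁻¹≡x^[q-2] x≢0) ⟩
    (x ^ (q-1 ℕ.∸ 1)) ^ suc n  ≡⟨ ^-assocʳ x (q-1 ℕ.∸ 1) (suc n) ⟩
    x ^ N                      ≡⟨ ^ᶻ-mod-q-1 x≢0 (ℤ.+ N) m (SD.∣⇒∣ᵤ q-1∣N-m) ⟩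
    x ^ m                      ∎
    where
    N = (q-1 ℕ.∸ 1) ℕ.* suc n
    N+1+n≡[1+n]*[q-1] : N ℕ.+ suc n ≡ suc n ℕ.* q-1
    N+1+n≡[1+n]*[q-1] = begin
      (q-1 ℕ.∸ 1) ℕ.* suc n ℕ.+ suc n    ≡⟨ cong (N ℕ.+_) (ℕP.*-identityˡ (suc n)) ⟨
      (q-1 ℕ.∸ 1) ℕ.* suc n ℕ.+ 1 ℕ.* suc n ≡⟨ ℕP.*-distribʳ-+ (suc n) (q-1 ℕ.∸ 1) 1 ⟨
      (q-1 ℕ.∸ 1 ℕ.+ 1) ℕ.* suc n        ≡⟨ cong (ℕ._* suc n) (ℕP.m∸n+n≡m 1≤q-1) ⟩
      q-1 ℕ.* suc n                      ≡⟨ ℕP.*-comm q-1 (suc n) ⟩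
      suc n ℕ.* q-1                      ∎
    q-1∣N-k : ℤ.+ q-1 SD.∣ (ℤ.+ N ℤ.- -[1+ n ])
    q-1∣N-k = subst (ℤ.+ q-1 SD.∣_)
      (sym (trans (sym (ℤP.pos-+ N (suc n))) (trans (cong ℤ.+_ N+1+n≡[1+n]*[q-1]) (ℤP.pos-* (suc n) q-1))))
      (SD.divides (ℤ.+ suc n) refl)
    q-1∣N-m : ℤ.+ q-1 SD.∣ (ℤ.+ N ℤ.- ℤ.+ m)
    q-1∣N-m = subst (ℤ.+ q-1 SD.∣_)
      (ℤSolver.solve 3 (λ a z b → (a ℤSolver.:- z) ℤSolver.:+ (z ℤSolver.:- b) ℤSolver.:= a ℤSolver.:- b) refl (ℤ.+ N) -[1+ n ] (ℤ.+ m))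
      (SD.∣m∣n⇒∣m+n q-1∣N-k (SD.∣ᵤ⇒∣ {k = ℤ.+ q-1} {i = -[1+ n ] ℤ.- ℤ.+ m} q-1∣k-m))

  powerSum : ℕ → Carrier
  powerSum m = Σ (map (_^ m) elements)

  powerSum-0 : powerSum 0 ≡ 0#
  powerSum-0 = trans (Σ-map-1 elements) characteristic-divides-order

  powerSum-q-1 : powerSum q-1 ≡ - 1#
  powerSum-q-1 = begin
    powerSum q-1                             ≡⟨ Σ-map-elements (_^ q-1) ⟩
    0# ^ q-1 + Σ (map (_^ q-1) nonzeros)     ≡⟨ cong₂ _+_ (0^n≡0 q-1 1≤q-1) (Σ-map-cong-∈ nonzeros
                                                    (All.tabulate (λ x∈ → fermat _ (nonzeros-nonzero x∈)))) ⟩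
    0# + Σ (map (λ _ → 1#) nonzeros)         ≡⟨ +-identityˡ _ ⟩
    Σ (map (λ _ → 1#) nonzeros)              ≡⟨ Σ-map-1 nonzeros ⟩
    fromℕ q-1                                ≡⟨ fromℕ[q-1]≡-1 ⟩
    - 1#                                     ∎
    where
    Σ-map-cong-∈ : ∀ {f g : Carrier → Carrier} xs → All (λ x → f x ≡ g x) xs → Σ (map f xs) ≡ Σ (map g xs)
    Σ-map-cong-∈ []       []       = refl
    Σ-map-cong-∈ (x ∷ xs) (p ∷ ps) = cong₂ _+_ p (Σ-map-cong-∈ xs ps)

  -- Scaling x by an a with a ^ m ≢ 1 multiplies powerSum m by a ^ m and permutes the summands.
  powerSum-small : ∀ m → 1 ≤ m → m < q-1 → powerSum m ≡ 0#
  powerSum-small m 1≤m m<q-1 with ^≢1-witness m 1≤m m<q-1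
  ... | a , a≢0 , a^m≢1 with x*y≡0⇒x≡0⊎y≡0 (a ^ m - 1#) (powerSum m) (begin
      (a ^ m - 1#) * powerSum m            ≡⟨ solve 3 (λ u o p → (u :- o) :* p := u :* p :- o :* p) refl (a ^ m) 1# (powerSum m) ⟩
      a ^ m * powerSum m - 1# * powerSum m ≡⟨ cong₂ _-_ scaled (*-identityˡ _) ⟩
      powerSum m - powerSum m              ≡⟨ -‿inverseʳ _ ⟩
      0#                                   ∎)
    where
    scaled : a ^ m * powerSum m ≡ powerSum m
    scaled = begin
      a ^ m * powerSum m                   ≡⟨ Σ-map-* (a ^ m) (_^ m) elements ⟨
      Σ (map (λ x → a ^ m * x ^ m) elements) ≡⟨ Σ-map-cong elements (λ x → sym (^-distrib-* a x m)) ⟩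
      Σ (map (λ x → (a * x) ^ m) elements)  ≡⟨ Σ-reindex (_^ m) (a *_) (a ⁻¹ *_) (cancel (⁻¹-inverseˡ a a≢0)) (cancel (⁻¹-inverse a a≢0)) ⟩
      powerSum m                            ∎
      where
      cancel : ∀ {b c} → b * c ≡ 1# → ∀ x → b * (c * x) ≡ x
      cancel bc≡1 x = trans (sym (*-assoc _ _ _)) (trans (cong (_* x) bc≡1) (*-identityˡ x))
  ... | inj₁ a^m-1≡0 = ⊥-elim (a^m≢1 (x-y≡0⇒x≡y a^m-1≡0))
  ... | inj₂ S≡0     = S≡0

  powerSum-periodic : ∀ m → 1 ≤ m → powerSum (q-1 ℕ.+ m) ≡ powerSum m
  powerSum-periodic m@(suc _) _ = Σ-map-cong elements shift
    where
    shift : ∀ x → x ^ (q-1 ℕ.+ m) ≡ x ^ m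
    shift x with x ≟ 0#
    ... | yes refl = trans (0^n≡0 (q-1 ℕ.+ m) (ℕP.≤-trans 1≤q-1 (ℕP.m≤m+n q-1 m))) (sym (0^n≡0 m (s≤s z≤n)))
    ... | no  x≢0  = trans (cong (x ^_) (ℕP.+-comm q-1 m))
                       (trans (cong (λ t → x ^ (m ℕ.+ t)) (sym (ℕP.*-identityˡ q-1))) (^-mod-q-1 x≢0 m 1))

  powerSum-vanishes : ∀ m → m < q-1 ℕ.+ q-1 → m ≢ q-1 → powerSum m ≡ 0#
  powerSum-vanishes zero      _ _ = powerSum-0
  powerSum-vanishes m@(suc _) m<2[q-1] m≢q-1 with ℕP.<-cmp m q-1
  ... | tri< m<q-1 _ _ = powerSum-small m (s≤s z≤n) m<q-1
  ... | tri≈ _ m≡q-1 _ = ⊥-elim (m≢q-1 m≡q-1)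
  ... | tri> _ _ m>q-1 = begin
      powerSum m                ≡⟨ cong powerSum (ℕP.m+[n∸m]≡n (ℕP.<⇒≤ m>q-1)) ⟨
      powerSum (q-1 ℕ.+ m′)     ≡⟨ powerSum-periodic m′ 1≤m′ ⟩
      powerSum m′               ≡⟨ powerSum-small m′ 1≤m′ m′<q-1 ⟩
      0#                        ∎
    where
    m′ = m ℕ.∸ q-1
    1≤m′ : 1 ≤ m′
    1≤m′ = ℕP.m<n⇒0<n∸m m>q-1
    m′<q-1 : m′ < q-1
    m′<q-1 = ℕP.+-cancelˡ-< q-1 m′ q-1 (subst (_< q-1 ℕ.+ q-1) (sym (ℕP.m+[n∸m]≡n (ℕP.<⇒≤ m>q-1))) m<2[q-1])

  -- Finite sums and the binomial theorem

  sumTo : ℕ → (ℕ → Carrier) → Carrier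
  sumTo zero    f = 0#
  sumTo (suc n) f = f 0 + sumTo n (f ∘ suc)

  syntax sumTo n (λ i → x) = ∑[ i < n ] x

  sumTo-cong : ∀ n {f g : ℕ → Carrier} → (∀ i → i < n → f i ≡ g i) → sumTo n f ≡ sumTo n g
  sumTo-cong zero    f≗g = refl
  sumTo-cong (suc n) f≗g = cong₂ _+_ (f≗g 0 (s≤s z≤n)) (sumTo-cong n (λ i i<n → f≗g (suc i) (s≤s i<n)))

  sumTo-* : ∀ n c (f : ℕ → Carrier) → ∑[ i < n ] (c * f i) ≡ c * sumTo n f
  sumTo-* zero    c f = sym (zeroʳ c)
  sumTo-* (suc n) c f = trans (cong (c * f 0 +_) (sumTo-* n c (f ∘ suc))) (sym (distribˡ _ _ _))

  sumTo-neg : ∀ n (f : ℕ → Carrier) → ∑[ i < n ] (- f i) ≡ - sumTo n f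
  sumTo-neg zero    f = sym -0#≈0#
  sumTo-neg (suc n) f = trans (cong (- f 0 +_) (sumTo-neg n (f ∘ suc))) (-‿+-comm _ _)

  sumTo-0 : ∀ n (f : ℕ → Carrier) → (∀ i → i < n → f i ≡ 0#) → sumTo n f ≡ 0#
  sumTo-0 n f f≡0 = trans (sumTo-cong n f≡0) (zeros n)
    where
    zeros : ∀ n → ∑[ i < n ] 0# ≡ 0#
    zeros zero    = refl
    zeros (suc n) = trans (+-identityˡ _) (zeros n)

  sumTo-single : ∀ n (f : ℕ → Carrier) j → j < n → (∀ i → i < n → i ≢ j → f i ≡ 0#) → sumTo n f ≡ f j
  sumTo-single (suc n) f zero    _         f≡0 =
    trans (cong (f 0 +_) (sumTo-0 n (f ∘ suc) (λ i i<n → f≡0 (suc i) (s≤s i<n) (λ ())))) (+-identityʳ _)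
  sumTo-single (suc n) f (suc j) (s≤s j<n) f≡0 =
    trans (cong₂ _+_ (f≡0 0 (s≤s z≤n) (λ ()))
                     (sumTo-single n (f ∘ suc) j j<n (λ i i<n i≢j → f≡0 (suc i) (s≤s i<n) (i≢j ∘ ℕP.suc-injective))))
          (+-identityˡ _)

  Σ-map-sumTo : ∀ {A : Set} n (g : ℕ → A → Carrier) xs →
                Σ (map (λ x → ∑[ j < n ] g j x) xs) ≡ ∑[ j < n ] Σ (map (g j) xs)
  Σ-map-sumTo zero    g xs = Σ-map-0 _ xs (All.universal (λ _ → refl) xs)
  Σ-map-sumTo (suc n) g xs = trans (Σ-map-+ (g 0) (λ x → sumTo n (λ j → g (suc j) x)) xs)
    (cong (Σ (map (g 0) xs) +_) (Σ-map-sumTo n (g ∘ suc) xs))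

  sumTo-even : ∀ L (g : ℕ → Carrier) → (∀ i → g (suc (2 ℕ.* i)) ≡ 0#) →
               sumTo (suc L) g ≡ ∑[ i < L ℕ./ 2 ℕ.+ 1 ] g (2 ℕ.* i)
  sumTo-even zero          g odd≡0 = refl
  sumTo-even (suc zero)    g odd≡0 = cong (g 0 +_) (trans (cong (_+ 0#) (odd≡0 0)) (+-identityˡ 0#))
  sumTo-even (suc (suc L)) g odd≡0 = begin
    g 0 + (g 1 + sumTo (suc L) (g ∘ suc ∘ suc))             ≡⟨ cong (λ t → g 0 + (t + sumTo (suc L) (g ∘ suc ∘ suc))) (odd≡0 0) ⟩
    g 0 + (0# + sumTo (suc L) (g ∘ suc ∘ suc))              ≡⟨ cong (g 0 +_) (+-identityˡ _) ⟩
    g 0 + sumTo (suc L) (g ∘ suc ∘ suc)                     ≡⟨ cong (g 0 +_) (sumTo-even L (g ∘ suc ∘ suc) odd≡0′) ⟩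
    g 0 + ∑[ i < L ℕ./ 2 ℕ.+ 1 ] g (2 ℕ.+ 2 ℕ.* i)          ≡⟨ cong (g 0 +_) (sumTo-cong (L ℕ./ 2 ℕ.+ 1) (λ i _ → cong g (sym (ℕP.*-suc 2 i)))) ⟩
    g 0 + ∑[ i < L ℕ./ 2 ℕ.+ 1 ] g (2 ℕ.* suc i)            ≡⟨ cong (λ N → ∑[ i < N ] g (2 ℕ.* i)) half ⟨
    ∑[ i < suc (suc L) ℕ./ 2 ℕ.+ 1 ] g (2 ℕ.* i)            ∎
    where
    odd≡0′ : ∀ i → g (suc (suc (suc (2 ℕ.* i)))) ≡ 0#
    odd≡0′ i = trans (cong (g ∘ suc) (sym (ℕP.*-suc 2 i))) (odd≡0 (suc i))
    half : suc (suc L) ℕ./ 2 ℕ.+ 1 ≡ suc (L ℕ./ 2 ℕ.+ 1)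
    half = cong (ℕ._+ 1) (ℕD.m/n≡1+[m∸n]/n {suc (suc L)} {2} (s≤s (s≤s z≤n)))

  Σ-map-applyUpTo : ∀ (f : ℕ → Carrier) (g : ℕ → ℕ) N → Σ (map f (applyUpTo g N)) ≡ ∑[ i < N ] f (g i)
  Σ-map-applyUpTo f g zero    = refl
  Σ-map-applyUpTo f g (suc N) = cong (f (g 0) +_) (Σ-map-applyUpTo f (g ∘ suc) N)

  private
    module Std where
      open CommutativeRing commutativeRing using (commutativeSemiring)
      open import Algebra.Properties.CommutativeSemiring.Binomial commutativeSemiring public
        using (theorem)
      open import Algebra.Properties.Semiring.Exp (CommutativeRing.semiring commutativeRing) public
        using (_^_)
      open import Algebra.Properties.Semiring.Mult (CommutativeRing.semiring commutativeRing) public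
        using (_×_)
      open import Algebra.Properties.Monoid.Sum (CommutativeRing.+-monoid commutativeRing) public
        using (sum)

    ^≡Std^ : ∀ x n → x Std.^ n ≡ x ^ n
    ^≡Std^ x zero    = refl
    ^≡Std^ x (suc n) = cong (x *_) (^≡Std^ x n)

    Std×≡fromℕ* : ∀ n x → n Std.× x ≡ fromℕ n * x
    Std×≡fromℕ* zero    x = sym (zeroˡ x)
    Std×≡fromℕ* (suc n) x = trans (cong₂ _+_ (sym (*-identityˡ x)) (Std×≡fromℕ* n x)) (sym (distribʳ _ _ _))

    Std-sum≡sumTo : ∀ n (f : ℕ → Carrier) → Std.sum {n} (f ∘ toℕ) ≡ sumTo n f
    Std-sum≡sumTo zero    f = refl
    Std-sum≡sumTo (suc n) f = cong (f 0 +_) (Std-sum≡sumTo n (f ∘ suc))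

  binomial : ∀ u v n → (u + v) ^ n ≡ ∑[ j < suc n ] (fromℕ (n C j) * u ^ (n ℕ.∸ j) * v ^ j)
  binomial u v n = begin
    (u + v) ^ n       ≡⟨ cong (_^ n) (+-comm u v) ⟩
    (v + u) ^ n       ≡⟨ ^≡Std^ (v + u) n ⟨
    (v + u) Std.^ n   ≡⟨ Std.theorem n v u ⟩
    Std.sum {suc n} (λ k → (n C toℕ k) Std.× (v Std.^ toℕ k * u Std.^ (n ℕ.∸ toℕ k)))
                      ≡⟨ Std-sum≡sumTo (suc n) (λ j → (n C j) Std.× (v Std.^ j * u Std.^ (n ℕ.∸ j))) ⟩
    ∑[ j < suc n ] ((n C j) Std.× (v Std.^ j * u Std.^ (n ℕ.∸ j)))
                      ≡⟨ sumTo-cong (suc n) (λ j _ → term j) ⟩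
    ∑[ j < suc n ] (fromℕ (n C j) * u ^ (n ℕ.∸ j) * v ^ j) ∎
    where
    term : ∀ j → (n C j) Std.× (v Std.^ j * u Std.^ (n ℕ.∸ j)) ≡ fromℕ (n C j) * u ^ (n ℕ.∸ j) * v ^ j
    term j = begin
      (n C j) Std.× (v Std.^ j * u Std.^ (n ℕ.∸ j)) ≡⟨ Std×≡fromℕ* (n C j) _ ⟩
      fromℕ (n C j) * (v Std.^ j * u Std.^ (n ℕ.∸ j)) ≡⟨ cong₂ (λ a b → fromℕ (n C j) * (a * b)) (^≡Std^ v j) (^≡Std^ u (n ℕ.∸ j)) ⟩
      fromℕ (n C j) * (v ^ j * u ^ (n ℕ.∸ j))        ≡⟨ solve 3 (λ c a b → c :* (a :* b) := c :* b :* a) refl (fromℕ (n C j)) (v ^ j) (u ^ (n ℕ.∸ j)) ⟩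
      fromℕ (n C j) * u ^ (n ℕ.∸ j) * v ^ j          ∎

  binomial-1+ : ∀ y n → (1# + y) ^ n ≡ ∑[ j < suc n ] (fromℕ (n C j) * y ^ j)
  binomial-1+ y n = trans (binomial 1# y n) (sumTo-cong (suc n) (λ j _ →
    cong (_* y ^ j) (trans (cong (fromℕ (n C j) *_) (1^n≡1 (n ℕ.∸ j))) (*-identityʳ _))))

  binomial-+1 : ∀ x n → (x + 1#) ^ n ≡ ∑[ j < suc n ] (fromℕ (n C j) * x ^ (n ℕ.∸ j))
  binomial-+1 x n = trans (binomial x 1# n) (sumTo-cong (suc n) (λ j _ →
    trans (cong (fromℕ (n C j) * x ^ (n ℕ.∸ j) *_) (1^n≡1 j)) (*-identityʳ _)))

  Σ-map-polynomial : ∀ a n (c : ℕ → Carrier) (e : ℕ → ℕ) →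
    Σ (map (λ x → x ^ a * ∑[ j < n ] (c j * x ^ e j)) elements) ≡ ∑[ j < n ] (c j * powerSum (a ℕ.+ e j))
  Σ-map-polynomial a n c e = begin
    Σ (map (λ x → x ^ a * ∑[ j < n ] (c j * x ^ e j)) elements)  ≡⟨ Σ-map-cong elements distribute ⟩
    Σ (map (λ x → ∑[ j < n ] (c j * x ^ (a ℕ.+ e j))) elements)  ≡⟨ Σ-map-sumTo n (λ j x → c j * x ^ (a ℕ.+ e j)) elements ⟩
    ∑[ j < n ] Σ (map (λ x → c j * x ^ (a ℕ.+ e j)) elements)   ≡⟨ sumTo-cong n (λ j _ → Σ-map-* (c j) (_^ (a ℕ.+ e j)) elements) ⟩
    ∑[ j < n ] (c j * powerSum (a ℕ.+ e j))                     ∎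
    where
    distribute : ∀ x → x ^ a * ∑[ j < n ] (c j * x ^ e j) ≡ ∑[ j < n ] (c j * x ^ (a ℕ.+ e j))
    distribute x = trans (sym (sumTo-* n (x ^ a) _)) (sumTo-cong n (λ j _ → begin
      x ^ a * (c j * x ^ e j)    ≡⟨ solve 3 (λ p c q → p :* (c :* q) := c :* (p :* q)) refl (x ^ a) (c j) (x ^ e j) ⟩
      c j * (x ^ a * x ^ e j)    ≡⟨ cong (c j *_) (^-homo-* x a (e j)) ⟨
      c j * x ^ (a ℕ.+ e j)      ∎))

  c*powerSum-vanishes : ∀ c {m} → m < q-1 ℕ.+ q-1 × m ≢ q-1 → c * powerSum m ≡ 0#
  c*powerSum-vanishes c {m} (m<2[q-1] , m≢q-1) = trans (cong (c *_) (powerSum-vanishes m m<2[q-1] m≢q-1)) (zeroʳ c)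

  sumTo-powerSum-single : ∀ n (c : ℕ → Carrier) (e : ℕ → ℕ) J → J < n → e J ≡ q-1 →
    (∀ j → j < n → j ≢ J → e j < q-1 ℕ.+ q-1 × e j ≢ q-1) → ∑[ j < n ] (c j * powerSum (e j)) ≡ - c J
  sumTo-powerSum-single n c e J J<n eJ≡q-1 others = begin
    ∑[ j < n ] (c j * powerSum (e j)) ≡⟨ sumTo-single n _ J J<n (λ j j<n j≢J → c*powerSum-vanishes (c j) (others j j<n j≢J)) ⟩
    c J * powerSum (e J)              ≡⟨ cong (λ t → c J * powerSum t) eJ≡q-1 ⟩
    c J * powerSum q-1                ≡⟨ cong (c J *_) powerSum-q-1 ⟩
    c J * - 1#                        ≡⟨ solve 1 (λ c → c :* (:- con (ℤ.+ 1)) := :- c) refl (c J) ⟩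
    - c J                             ∎

  sumTo-powerSum-0 : ∀ n (c : ℕ → Carrier) (e : ℕ → ℕ) →
    (∀ j → j < n → e j < q-1 ℕ.+ q-1 × e j ≢ q-1) → ∑[ j < n ] (c j * powerSum (e j)) ≡ 0#
  sumTo-powerSum-0 n c e bounds = sumTo-0 n _ (λ j j<n → c*powerSum-vanishes (c j) (bounds j j<n))

  -- Binomial coefficients evaluated through power sums

  sumTo-binomial-even : ∀ L (a I : ℕ → Carrier) → (∀ m → suc (2 ℕ.* m) ≤ L → I (suc (2 ℕ.* m)) ≡ 0#) →
    ∑[ j < suc L ] (fromℕ (L C j) * a j * I j) ≡ ∑[ m < L ℕ./ 2 ℕ.+ 1 ] (fromℕ (L C (2 ℕ.* m)) * a (2 ℕ.* m) * I (2 ℕ.* m))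
  sumTo-binomial-even L a I odd≡0 = sumTo-even L (λ j → fromℕ (L C j) * a j * I j) vanish
    where
    vanish : ∀ m → fromℕ (L C suc (2 ℕ.* m)) * a (suc (2 ℕ.* m)) * I (suc (2 ℕ.* m)) ≡ 0#
    vanish m with suc (2 ℕ.* m) ℕ.≤? L
    ... | yes j≤L = trans (cong (_ *_) (odd≡0 m j≤L)) (zeroʳ _)
    ... | no  j≰L rewrite k>n⇒nCk≡0 (ℕP.≰⇒> j≰L) = trans (cong (_* I (suc (2 ℕ.* m))) (zeroˡ _)) (zeroˡ _)

  two : Carrier
  two = 1# + 1#

  Σ-x^a[c+x²]^n : ∀ a c n → Σ (map (λ x → x ^ a * (c + x ^ 2) ^ n) elements)
                             ≡ ∑[ t < suc n ] (fromℕ (n C t) * c ^ (n ℕ.∸ t) * powerSum (a ℕ.+ 2 ℕ.* t))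
  Σ-x^a[c+x²]^n a c n = trans (Σ-map-cong elements expand)
    (Σ-map-polynomial a (suc n) (λ t → fromℕ (n C t) * c ^ (n ℕ.∸ t)) (2 ℕ.*_))
    where
    expand : ∀ x → x ^ a * (c + x ^ 2) ^ n ≡ x ^ a * ∑[ t < suc n ] (fromℕ (n C t) * c ^ (n ℕ.∸ t) * x ^ (2 ℕ.* t))
    expand x = cong (x ^ a *_) (trans (binomial c (x ^ 2) n)
                 (sumTo-cong (suc n) (λ t _ → cong (fromℕ (n C t) * c ^ (n ℕ.∸ t) *_) (^-assocʳ x 2 t))))

  -- For j < q - 1, only s = j / 2 can make (q - 1 - j) + 2 s equal q - 1.
  Σ-x^[q-1∸2m][1+x²]^2m : ∀ m → 2 ℕ.* m < q-1 →
    Σ (map (λ x → x ^ (q-1 ℕ.∸ 2 ℕ.* m) * (1# + x ^ 2) ^ (2 ℕ.* m)) elements) ≡ - fromℕ ((2 ℕ.* m) C m)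
  Σ-x^[q-1∸2m][1+x²]^2m m 2m<q-1 = trans (Σ-x^a[c+x²]^n (q-1 ℕ.∸ 2 ℕ.* m) 1# (2 ℕ.* m))
    (trans (sumTo-powerSum-single (suc (2 ℕ.* m)) (λ s → fromℕ ((2 ℕ.* m) C s) * 1# ^ (2 ℕ.* m ℕ.∸ s)) (λ s → q-1 ℕ.∸ 2 ℕ.* m ℕ.+ 2 ℕ.* s) m
      (s≤s (ℕP.m≤n*m m 2)) (ℕP.m∸n+n≡m (ℕP.<⇒≤ 2m<q-1))
      (λ s s≤2m s≢m → [n∸j]+k<n+n 2m<q-1 (ℕP.*-monoʳ-≤ 2 (ℕP.≤-pred s≤2m))
                    , s≢m ∘ ℕP.*-cancelˡ-≡ s m 2 ∘ [n∸j]+k≡n⇒k≡j (ℕP.<⇒≤ 2m<q-1)))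
      (cong -_ (trans (cong (fromℕ ((2 ℕ.* m) C m) *_) (1^n≡1 (2 ℕ.* m ℕ.∸ m))) (*-identityʳ _))))

  Σ-x^[q-1∸1+2m][1+x²]^1+2m : ∀ m → suc (2 ℕ.* m) < q-1 →
    Σ (map (λ x → x ^ (q-1 ℕ.∸ suc (2 ℕ.* m)) * (1# + x ^ 2) ^ suc (2 ℕ.* m)) elements) ≡ 0#
  Σ-x^[q-1∸1+2m][1+x²]^1+2m m j<q-1 = trans (Σ-x^a[c+x²]^n (q-1 ℕ.∸ suc (2 ℕ.* m)) 1# (suc (2 ℕ.* m)))
    (sumTo-powerSum-0 (suc (suc (2 ℕ.* m))) (λ s → fromℕ (suc (2 ℕ.* m) C s) * 1# ^ (suc (2 ℕ.* m) ℕ.∸ s)) (λ s → q-1 ℕ.∸ suc (2 ℕ.* m) ℕ.+ 2 ℕ.* s)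
      (λ s s≤j → [n∸j]+k<n+n j<q-1 (ℕP.*-monoʳ-≤ 2 (ℕP.≤-pred s≤j))
               , ℕP.even≢odd s m ∘ [n∸j]+k≡n⇒k≡j (ℕP.<⇒≤ j<q-1)))

  -- The integer identity C(2i, i) = ∑ₘ C(i, 2m) 2^(i-2m) C(2m, m), read off from Σₓ x^(q-1-i) (1 + x)^(2i)
  -- computed once directly and once through (1 + x)² = 2x + (1 + x²).
  central-binomial-expansion : ∀ i → i < q-1 →
    fromℕ ((2 ℕ.* i) C i) ≡ ∑[ m < i ℕ./ 2 ℕ.+ 1 ] (fromℕ (i C (2 ℕ.* m)) * two ^ (i ℕ.∸ 2 ℕ.* m) * fromℕ ((2 ℕ.* m) C m))
  central-binomial-expansion i i<q-1 = -‿injective (begin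
    - fromℕ ((2 ℕ.* i) C i)                                  ≡⟨ Q-directly ⟨
    Q                                                        ≡⟨ Q-via-squares ⟩
    ∑[ m < N ] (A (2 ℕ.* m) * - fromℕ ((2 ℕ.* m) C m))       ≡⟨ sumTo-cong N (λ m _ → -‿distribʳ-* (A (2 ℕ.* m)) _) ⟨
    ∑[ m < N ] (- (A (2 ℕ.* m) * fromℕ ((2 ℕ.* m) C m)))     ≡⟨ sumTo-neg N _ ⟩
    - ∑[ m < N ] (A (2 ℕ.* m) * fromℕ ((2 ℕ.* m) C m))       ∎)
    where
    N = i ℕ./ 2 ℕ.+ 1
    r = q-1 ℕ.∸ i
    Q = Σ (map (λ x → x ^ r * (1# + x) ^ (2 ℕ.* i)) elements)
    A : ℕ → Carrier
    A j = fromℕ (i C j) * two ^ (i ℕ.∸ j)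
    f : ℕ → Carrier → Carrier
    f j x = x ^ (q-1 ℕ.∸ j) * (1# + x ^ 2) ^ j

    Q-directly : Q ≡ - fromℕ ((2 ℕ.* i) C i)
    Q-directly = begin
      Q                                                                    ≡⟨ Σ-map-cong elements (λ x → cong (x ^ r *_) (binomial-1+ x (2 ℕ.* i))) ⟩
      Σ (map (λ x → x ^ r * ∑[ s < suc (2 ℕ.* i) ] (c s * x ^ s)) elements)  ≡⟨ Σ-map-polynomial r (suc (2 ℕ.* i)) c (λ s → s) ⟩
      ∑[ s < suc (2 ℕ.* i) ] (c s * powerSum (r ℕ.+ s))                      ≡⟨ sumTo-powerSum-single (suc (2 ℕ.* i)) c (r ℕ.+_) i
                                                                                  (s≤s (ℕP.m≤n*m i 2)) (ℕP.m∸n+n≡m (ℕP.<⇒≤ i<q-1))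
                                                                                  (λ s s<1+2i s≢i → [n∸j]+k<n+n i<q-1 (ℕP.≤-pred s<1+2i)
                                                                                                , s≢i ∘ [n∸j]+k≡n⇒k≡j (ℕP.<⇒≤ i<q-1)) ⟩
      - c i                                                                ∎
      where
      c : ℕ → Carrier
      c s = fromℕ ((2 ℕ.* i) C s)

    expand : ∀ x → x ^ r * (1# + x) ^ (2 ℕ.* i) ≡ ∑[ j < suc i ] (A j * f j x)
    expand x = begin
      x ^ r * (1# + x) ^ (2 ℕ.* i)                          ≡⟨ cong (x ^ r *_) (^-assocʳ (1# + x) 2 i) ⟨
      x ^ r * ((1# + x) ^ 2) ^ i                            ≡⟨ cong (λ t → x ^ r * t ^ i) square ⟩
      x ^ r * (two * x + (1# + x ^ 2)) ^ i                  ≡⟨ cong (x ^ r *_) (binomial (two * x) (1# + x ^ 2) i) ⟩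
      x ^ r * ∑[ j < suc i ] t j                            ≡⟨ sumTo-* (suc i) (x ^ r) t ⟨
      ∑[ j < suc i ] (x ^ r * t j)                          ≡⟨ sumTo-cong (suc i) (λ j j<1+i → regroup j (ℕP.≤-pred j<1+i)) ⟩
      ∑[ j < suc i ] (A j * f j x)                          ∎
      where
      t : ℕ → Carrier
      t j = fromℕ (i C j) * (two * x) ^ (i ℕ.∸ j) * (1# + x ^ 2) ^ j
      square : (1# + x) ^ 2 ≡ two * x + (1# + x ^ 2)
      square = solve 1 (λ x → (con (ℤ.+ 1) :+ x) :* ((con (ℤ.+ 1) :+ x) :* con (ℤ.+ 1))
                              := con (ℤ.+ 2) :* x :+ (con (ℤ.+ 1) :+ x :* (x :* con (ℤ.+ 1)))) refl x
      regroup : ∀ j → j ≤ i → x ^ r * t j ≡ A j * f j x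
      regroup j j≤i = begin
        x ^ r * (c * (two * x) ^ (i ℕ.∸ j) * v)              ≡⟨ cong (λ u → x ^ r * (c * u * v)) (^-distrib-* two x (i ℕ.∸ j)) ⟩
        x ^ r * (c * (two ^ (i ℕ.∸ j) * x ^ (i ℕ.∸ j)) * v)  ≡⟨ solve 5 (λ X c T Y v → X :* (c :* (T :* Y) :* v) := c :* T :* ((X :* Y) :* v))
                                                                  refl (x ^ r) c (two ^ (i ℕ.∸ j)) (x ^ (i ℕ.∸ j)) v ⟩
        A j * ((x ^ r * x ^ (i ℕ.∸ j)) * v)                  ≡⟨ cong (λ u → A j * (u * v)) (^-homo-* x r (i ℕ.∸ j)) ⟨
        A j * (x ^ (r ℕ.+ (i ℕ.∸ j)) * v)                    ≡⟨ cong (λ e → A j * (x ^ e * v)) exponent ⟩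
        A j * f j x                                          ∎
        where
        c = fromℕ (i C j)
        v = (1# + x ^ 2) ^ j
        exponent : r ℕ.+ (i ℕ.∸ j) ≡ q-1 ℕ.∸ j
        exponent = trans (sym (ℕP.+-∸-assoc r j≤i)) (cong (ℕ._∸ j) (ℕP.m∸n+n≡m (ℕP.<⇒≤ i<q-1)))

    Q-via-squares : Q ≡ ∑[ m < N ] (A (2 ℕ.* m) * - fromℕ ((2 ℕ.* m) C m))
    Q-via-squares = begin
      Q                                                   ≡⟨ Σ-map-cong elements expand ⟩
      Σ (map (λ x → ∑[ j < suc i ] (A j * f j x)) elements) ≡⟨ Σ-map-sumTo (suc i) (λ j x → A j * f j x) elements ⟩
      ∑[ j < suc i ] Σ (map (λ x → A j * f j x) elements)   ≡⟨ sumTo-cong (suc i) (λ j _ → Σ-map-* (A j) (f j) elements) ⟩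
      ∑[ j < suc i ] (fromℕ (i C j) * two ^ (i ℕ.∸ j) * Σ (map (f j) elements))
                                                          ≡⟨ sumTo-binomial-even i (λ j → two ^ (i ℕ.∸ j)) (λ j → Σ (map (f j) elements))
                                                               (λ m j≤i → Σ-x^[q-1∸1+2m][1+x²]^1+2m m (ℕP.≤-<-trans j≤i i<q-1)) ⟩
      ∑[ m < N ] (A (2 ℕ.* m) * Σ (map (f (2 ℕ.* m)) elements))
                                                          ≡⟨ sumTo-cong N (λ m m<N → cong (A (2 ℕ.* m) *_)
                                                               (Σ-x^[q-1∸2m][1+x²]^2m m (ℕP.≤-<-trans (m<⌊i/2⌋+1⇒2m≤i i m m<N) i<q-1))) ⟩
      ∑[ m < N ] (A (2 ℕ.* m) * - fromℕ ((2 ℕ.* m) C m))  ∎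

  module _ (q-odd : order ℕ.% 2 ≡ 1) where

    h : ℕ
    h = (order ℕ.∸ 1) ℕ./ 2

    q-1≡h+h : q-1 ≡ h ℕ.+ h
    q-1≡h+h = begin
      q-1                        ≡⟨ cong (ℕ._∸ 1) order≡1+q-1 ⟨
      order ℕ.∸ 1                ≡⟨ order-1≡half*2 ⟩
      half ℕ.* 2                 ≡⟨ cong (ℕ._* 2) (ℕD.m*n/n≡m half 2) ⟨
      (half ℕ.* 2) ℕ./ 2 ℕ.* 2   ≡⟨ cong (λ n → n ℕ./ 2 ℕ.* 2) order-1≡half*2 ⟨
      h ℕ.* 2                    ≡⟨ ℕP.*-comm h 2 ⟩
      h ℕ.+ (h ℕ.+ 0)            ≡⟨ cong (h ℕ.+_) (ℕP.+-identityʳ h) ⟩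
      h ℕ.+ h                    ∎
      where
      half = order ℕ./ 2
      order-1≡half*2 : order ℕ.∸ 1 ≡ half ℕ.* 2
      order-1≡half*2 = cong (ℕ._∸ 1) (trans (ℕD.m≡m%n+[m/n]*n order 2) (cong (ℕ._+ half ℕ.* 2) q-odd))

    1≤h : 1 ≤ h
    1≤h with h | q-1≡h+h
    ... | zero  | q-1≡0 = ⊥-elim (ℕP.<⇒≢ 1≤q-1 (sym q-1≡0))
    ... | suc _ | _     = s≤s z≤n

    two*h≡-1 : two * fromℕ h ≡ - 1#
    two*h≡-1 = begin
      two * fromℕ h          ≡⟨ solve 1 (λ a → con (ℤ.+ 2) :* a := a :+ a) refl (fromℕ h) ⟩
      fromℕ h + fromℕ h      ≡⟨ fromℕ-+ h h ⟨
      fromℕ (h ℕ.+ h)        ≡⟨ cong fromℕ q-1≡h+h ⟨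
      fromℕ q-1              ≡⟨ fromℕ[q-1]≡-1 ⟩
      - 1#                   ∎

    two≢0 : two ≢ 0#
    two≢0 two≡0 = 1≢0 (-‿injective (trans (sym two*h≡-1) (trans (cong (_* fromℕ h) two≡0) (trans (zeroˡ _) (sym -0#≈0#)))))

    ½ : Carrier
    ½ = two ⁻¹

    two*½≡1 : two * ½ ≡ 1#
    two*½≡1 = ⁻¹-inverse two two≢0

    sumTo-powerSum-single-h : ∀ n (c : ℕ → Carrier) (e : ℕ → ℕ) J → J < n → e J ≡ h ℕ.+ h →
      (∀ j → j < n → j ≢ J → e j < (h ℕ.+ h) ℕ.+ (h ℕ.+ h) × e j ≢ h ℕ.+ h) → ∑[ j < n ] (c j * powerSum (e j)) ≡ - c J
    sumTo-powerSum-single-h n c e J J<n eJ others = sumTo-powerSum-single n c e J J<n (trans eJ (sym q-1≡h+h))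
      (λ j j<n j≢J → subst (λ N → e j < N ℕ.+ N × e j ≢ N) (sym q-1≡h+h) (others j j<n j≢J))

    sumTo-powerSum-0-h : ∀ n (c : ℕ → Carrier) (e : ℕ → ℕ) →
      (∀ j → j < n → e j < (h ℕ.+ h) ℕ.+ (h ℕ.+ h) × e j ≢ h ℕ.+ h) → ∑[ j < n ] (c j * powerSum (e j)) ≡ 0#
    sumTo-powerSum-0-h n c e bounds = sumTo-powerSum-0 n c e
      (λ j j<n → subst (λ N → e j < N ℕ.+ N × e j ≢ N) (sym q-1≡h+h) (bounds j j<n))

    powerSum-0-h : ∀ m → m < (h ℕ.+ h) ℕ.+ (h ℕ.+ h) → m ≢ h ℕ.+ h → powerSum m ≡ 0#
    powerSum-0-h m m<4h m≢2h = powerSum-vanishes m (subst (λ N → m < N ℕ.+ N) (sym q-1≡h+h) m<4h)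
      (λ m≡q-1 → m≢2h (trans m≡q-1 q-1≡h+h))

    ¼ -½ -¼ : Carrier
    ¼ = ½ * ½
    -½ = - ½
    -¼ = - ¼

    Σ-x^a[1+x]^h : ∀ a → Σ (map (λ x → x ^ a * (1# + x) ^ h) elements) ≡ ∑[ j < suc h ] (fromℕ (h C j) * powerSum (a ℕ.+ j))
    Σ-x^a[1+x]^h a = trans (Σ-map-cong elements (λ x → cong (x ^ a *_) (binomial-1+ x h)))
      (Σ-map-polynomial a (suc h) (λ j → fromℕ (h C j)) (λ j → j))

    Σ-x^a[x+1]^h : ∀ a → Σ (map (λ x → x ^ a * (x + 1#) ^ h) elements) ≡ ∑[ j < suc h ] (fromℕ (h C j) * powerSum (a ℕ.+ (h ℕ.∸ j)))
    Σ-x^a[x+1]^h a = trans (Σ-map-cong elements (λ x → cong (x ^ a *_) (binomial-+1 x h)))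
      (Σ-map-polynomial a (suc h) (λ j → fromℕ (h C j)) (h ℕ.∸_))

    Σ-x^[ℓ+h][1+x]^h : ∀ ℓ → ℓ < h → Σ (map (λ x → x ^ (ℓ ℕ.+ h) * (1# + x) ^ h) elements) ≡ - fromℕ (h C (h ℕ.∸ ℓ))
    Σ-x^[ℓ+h][1+x]^h ℓ ℓ<h = trans (Σ-x^a[1+x]^h (ℓ ℕ.+ h))
      (sumTo-powerSum-single-h (suc h) (λ j → fromℕ (h C j)) (ℓ ℕ.+ h ℕ.+_) (h ℕ.∸ ℓ)
        (s≤s (ℕP.m∸n≤m h ℓ)) (ℓ+h+[h∸ℓ]≡h+h (ℕP.<⇒≤ ℓ<h))
        (λ j j<1+h j≢h∸ℓ → ℓ+h+s<4h ℓ<h (ℕP.≤-pred j<1+h) , j≢h∸ℓ ∘ ℓ+h+s≡h+h⇒s≡h∸ℓ {ℓ} {h}))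

    powerSum-<h+h : ∀ {m} → m < h ℕ.+ h → powerSum m ≡ 0#
    powerSum-<h+h m<2h = powerSum-0-h _ (ℕP.<-≤-trans m<2h (ℕP.m≤m+n _ _)) (ℕP.<⇒≢ m<2h)

    -- Σₓ x^ℓ (x (x + 1))^h computed directly and after the shift x = y - ½, which turns x (x + 1) into y² - ¼.
    binomial-h-recurrence : ∀ ℓ → ℓ < h →
      fromℕ (h C (h ℕ.∸ ℓ)) ≡ ∑[ i < ℓ ℕ./ 2 ℕ.+ 1 ] (fromℕ (ℓ C (2 ℕ.* i)) * -½ ^ (ℓ ℕ.∸ 2 ℕ.* i) * (fromℕ (h C (h ℕ.∸ i)) * -¼ ^ i))
    binomial-h-recurrence ℓ ℓ<h = -‿injective (begin
      - fromℕ (h C (h ℕ.∸ ℓ))                        ≡⟨ Q-directly ⟨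
      Q                                              ≡⟨ Q-shifted ⟩
      ∑[ i < N ] (A (2 ℕ.* i) * - K i)               ≡⟨ sumTo-cong N (λ i _ → -‿distribʳ-* (A (2 ℕ.* i)) (K i)) ⟨
      ∑[ i < N ] (- (A (2 ℕ.* i) * K i))             ≡⟨ sumTo-neg N (λ i → A (2 ℕ.* i) * K i) ⟩
      - ∑[ i < N ] (A (2 ℕ.* i) * K i)               ∎)
      where
      N = ℓ ℕ./ 2 ℕ.+ 1
      f : Carrier → Carrier
      f x = x ^ ℓ * (x * (x + 1#)) ^ h
      Q = Σ (map f elements)
      A : ℕ → Carrier
      A j = fromℕ (ℓ C j) * -½ ^ (ℓ ℕ.∸ j)
      K : ℕ → Carrier
      K i = fromℕ (h C (h ℕ.∸ i)) * -¼ ^ i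
      I : ℕ → Carrier
      I j = Σ (map (λ y → y ^ j * (-¼ + y ^ 2) ^ h) elements)

      Q-directly : Q ≡ - fromℕ (h C (h ℕ.∸ ℓ))
      Q-directly = trans (Σ-map-cong elements regroup) (Σ-x^[ℓ+h][1+x]^h ℓ ℓ<h)
        where
        regroup : ∀ x → f x ≡ x ^ (ℓ ℕ.+ h) * (1# + x) ^ h
        regroup x = begin
          x ^ ℓ * (x * (x + 1#)) ^ h          ≡⟨ cong (x ^ ℓ *_) (^-distrib-* x (x + 1#) h) ⟩
          x ^ ℓ * (x ^ h * (x + 1#) ^ h)      ≡⟨ *-assoc _ _ _ ⟨
          (x ^ ℓ * x ^ h) * (x + 1#) ^ h      ≡⟨ cong₂ _*_ (^-homo-* x ℓ h) (cong (_^ h) (+-comm 1# x)) ⟨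
          x ^ (ℓ ℕ.+ h) * (1# + x) ^ h        ∎

      I-even : ∀ i → 2 ℕ.* i ≤ ℓ → I (2 ℕ.* i) ≡ - K i
      I-even i 2i≤ℓ = begin
        I (2 ℕ.* i)
          ≡⟨ Σ-x^a[c+x²]^n (2 ℕ.* i) -¼ h ⟩
        ∑[ t < suc h ] (c t * powerSum (2 ℕ.* i ℕ.+ 2 ℕ.* t))
          ≡⟨ sumTo-powerSum-single-h (suc h) c (λ t → 2 ℕ.* i ℕ.+ 2 ℕ.* t) (h ℕ.∸ i)
                 (s≤s (ℕP.m∸n≤m h i)) (2i+2[h∸i]≡h+h i≤h)
                 (λ t t<1+h t≢h∸i → j+2t<4h 2i<h (ℕP.≤-pred t<1+h) , t≢h∸i ∘ 2i+2t≡h+h⇒t≡h∸i {i} {t} {h}) ⟩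
        - c (h ℕ.∸ i)
          ≡⟨ cong (λ e → - (fromℕ (h C (h ℕ.∸ i)) * -¼ ^ e)) (ℕP.m∸[m∸n]≡n i≤h) ⟩
        - K i
          ∎
        where
        c : ℕ → Carrier
        c t = fromℕ (h C t) * -¼ ^ (h ℕ.∸ t)
        2i<h : 2 ℕ.* i < h
        2i<h = ℕP.≤-<-trans 2i≤ℓ ℓ<h
        i≤h : i ≤ h
        i≤h = ℕP.≤-trans (ℕP.m≤n*m i 2) (ℕP.<⇒≤ 2i<h)

      I-odd : ∀ i → suc (2 ℕ.* i) ≤ ℓ → I (suc (2 ℕ.* i)) ≡ 0#
      I-odd i j≤ℓ = trans (Σ-x^a[c+x²]^n (suc (2 ℕ.* i)) -¼ h)
        (sumTo-powerSum-0-h (suc h) (λ t → fromℕ (h C t) * -¼ ^ (h ℕ.∸ t)) (λ t → suc (2 ℕ.* i) ℕ.+ 2 ℕ.* t)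
          (λ t t<1+h → j+2t<4h (ℕP.≤-<-trans j≤ℓ ℓ<h) (ℕP.≤-pred t<1+h) , 1+2i+2t≢h+h i t h))

      shift : ∀ y → f (y + -½) ≡ ∑[ j < suc ℓ ] (A j * (y ^ j * (-¼ + y ^ 2) ^ h))
      shift y = begin
        (y + -½) ^ ℓ * ((y + -½) * ((y + -½) + 1#)) ^ h
          ≡⟨ cong₂ (λ a b → a ^ ℓ * b ^ h) (+-comm y -½) square ⟩
        (-½ + y) ^ ℓ * B
          ≡⟨ cong (_* B) (binomial -½ y ℓ) ⟩
        ∑[ j < suc ℓ ] (A j * y ^ j) * B
          ≡⟨ *-comm _ B ⟩
        B * ∑[ j < suc ℓ ] (A j * y ^ j)
          ≡⟨ sumTo-* (suc ℓ) B (λ j → A j * y ^ j) ⟨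
        ∑[ j < suc ℓ ] (B * (A j * y ^ j))
          ≡⟨ sumTo-cong (suc ℓ) (λ j _ → solve 3 (λ b a t → b :* (a :* t) := a :* (t :* b)) refl B (A j) (y ^ j)) ⟩
        ∑[ j < suc ℓ ] (A j * (y ^ j * B))
          ∎
        where
        B = (-¼ + y ^ 2) ^ h
        square : (y + -½) * ((y + -½) + 1#) ≡ -¼ + y ^ 2
        square = begin
          (y + -½) * ((y + -½) + 1#)              ≡⟨ solve 2 (λ y w → (y :+ (:- w)) :* ((y :+ (:- w)) :+ con (ℤ.+ 1))
                                                               := ((:- (w :* w)) :+ y :* (y :* con (ℤ.+ 1))) :+ (y :- w) :* (con (ℤ.+ 1) :- con (ℤ.+ 2) :* w))
                                                        refl y ½ ⟩
          (-¼ + y ^ 2) + (y - ½) * (1# - two * ½)  ≡⟨ cong (λ t → (-¼ + y ^ 2) + (y - ½) * (1# - t)) two*½≡1 ⟩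
          (-¼ + y ^ 2) + (y - ½) * (1# - 1#)       ≡⟨ cong (λ t → (-¼ + y ^ 2) + (y - ½) * t) (-‿inverseʳ 1#) ⟩
          (-¼ + y ^ 2) + (y - ½) * 0#              ≡⟨ trans (cong ((-¼ + y ^ 2) +_) (zeroʳ _)) (+-identityʳ _) ⟩
          -¼ + y ^ 2                               ∎

      Q-shifted : Q ≡ ∑[ i < N ] (A (2 ℕ.* i) * - K i)
      Q-shifted = begin
        Q
          ≡⟨ Σ-reindex f (_+ -½) (_- -½) (λ y → solve 2 (λ y m → (y :+ m) :- m := y) refl y -½)
                                           (λ x → solve 2 (λ x m → (x :- m) :+ m := x) refl x -½) ⟨
        Σ (map (λ y → f (y + -½)) elements)
          ≡⟨ Σ-map-cong elements shift ⟩
        Σ (map (λ y → ∑[ j < suc ℓ ] (A j * (y ^ j * (-¼ + y ^ 2) ^ h))) elements)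
          ≡⟨ Σ-map-sumTo (suc ℓ) (λ j y → A j * (y ^ j * (-¼ + y ^ 2) ^ h)) elements ⟩
        ∑[ j < suc ℓ ] Σ (map (λ y → A j * (y ^ j * (-¼ + y ^ 2) ^ h)) elements)
          ≡⟨ sumTo-cong (suc ℓ) (λ j _ → Σ-map-* (A j) (λ y → y ^ j * (-¼ + y ^ 2) ^ h) elements) ⟩
        ∑[ j < suc ℓ ] (fromℕ (ℓ C j) * -½ ^ (ℓ ℕ.∸ j) * I j)
          ≡⟨ sumTo-binomial-even ℓ (λ j → -½ ^ (ℓ ℕ.∸ j)) I I-odd ⟩
        ∑[ i < N ] (A (2 ℕ.* i) * I (2 ℕ.* i))
          ≡⟨ sumTo-cong N (λ i i<N → cong (A (2 ℕ.* i) *_) (I-even i (m<⌊i/2⌋+1⇒2m≤i ℓ i i<N))) ⟩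
        ∑[ i < N ] (A (2 ℕ.* i) * - K i)
          ∎

    -¼*two≡-½ : -¼ * two ≡ -½
    -¼*two≡-½ = begin
      - (½ * ½) * two    ≡⟨ solve 2 (λ w t → (:- (w :* w)) :* t := :- (w :* (t :* w))) refl ½ two ⟩
      - (½ * (two * ½))  ≡⟨ cong (λ t → - (½ * t)) two*½≡1 ⟩
      - (½ * 1#)         ≡⟨ cong -_ (*-identityʳ ½) ⟩
      - ½                ∎

    ^-split : ∀ x i j → 2 ℕ.* j ≤ i → x ^ i ≡ x ^ (i ℕ.∸ 2 ℕ.* j) * (x ^ j * x ^ j)
    ^-split x i j 2j≤i = begin
      x ^ i                                ≡⟨ cong (x ^_) (ℕP.m∸n+n≡m 2j≤i) ⟨
      x ^ (i ℕ.∸ 2 ℕ.* j ℕ.+ 2 ℕ.* j)      ≡⟨ ^-homo-* x (i ℕ.∸ 2 ℕ.* j) (2 ℕ.* j) ⟩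
      x ^ (i ℕ.∸ 2 ℕ.* j) * x ^ (2 ℕ.* j)  ≡⟨ cong (x ^ (i ℕ.∸ 2 ℕ.* j) *_) (^-homo-* x j (j ℕ.+ 0)) ⟩
      x ^ (i ℕ.∸ 2 ℕ.* j) * (x ^ j * x ^ (j ℕ.+ 0)) ≡⟨ cong (λ e → x ^ (i ℕ.∸ 2 ℕ.* j) * (x ^ j * x ^ e)) (ℕP.+-identityʳ j) ⟩
      x ^ (i ℕ.∸ 2 ℕ.* j) * (x ^ j * x ^ j) ∎

    -- Since h ≡ -½ in the field, this is C(-½, i) = (-¼)^i C(2i, i); it follows from the recurrence by
    -- strong induction on i, the recurrence closing up through the central binomial expansion.
    binomial-h≡central : ∀ i → i < h → fromℕ (h C (h ℕ.∸ i)) ≡ fromℕ ((2 ℕ.* i) C i) * -¼ ^ i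
    binomial-h≡central = <-rec _ step
      where
      step : ∀ i → (∀ {m} → m < i → m < h → fromℕ (h C (h ℕ.∸ m)) ≡ fromℕ ((2 ℕ.* m) C m) * -¼ ^ m) →
             i < h → fromℕ (h C (h ℕ.∸ i)) ≡ fromℕ ((2 ℕ.* i) C i) * -¼ ^ i
      step zero      _  _   = trans (cong fromℕ (nCn≡1 h)) (sym (*-identityʳ _))
      step i@(suc _) IH i<h = begin
        fromℕ (h C (h ℕ.∸ i))                                              ≡⟨ binomial-h-recurrence i i<h ⟩
        ∑[ m < N ] (A m * (fromℕ (h C (h ℕ.∸ m)) * -¼ ^ m))                ≡⟨ sumTo-cong N (λ m m<N → cong (λ t → A m * (t * -¼ ^ m))
                                                                                (IH (m<i m m<N) (ℕP.<-trans (m<i m m<N) i<h))) ⟩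
        ∑[ m < N ] (A m * (fromℕ ((2 ℕ.* m) C m) * -¼ ^ m * -¼ ^ m))       ≡⟨ sumTo-cong N (λ m m<N → regroup m (m<⌊i/2⌋+1⇒2m≤i i m m<N)) ⟩
        ∑[ m < N ] (-¼ ^ i * (fromℕ (i C (2 ℕ.* m)) * two ^ (i ℕ.∸ 2 ℕ.* m) * fromℕ ((2 ℕ.* m) C m)))
                                                                           ≡⟨ sumTo-* N (-¼ ^ i) _ ⟩
        -¼ ^ i * ∑[ m < N ] (fromℕ (i C (2 ℕ.* m)) * two ^ (i ℕ.∸ 2 ℕ.* m) * fromℕ ((2 ℕ.* m) C m))
                                                                           ≡⟨ cong (-¼ ^ i *_) (central-binomial-expansion i i<q-1) ⟨
        -¼ ^ i * fromℕ ((2 ℕ.* i) C i)                                     ≡⟨ *-comm _ _ ⟩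
        fromℕ ((2 ℕ.* i) C i) * -¼ ^ i                                     ∎
        where
        N = i ℕ./ 2 ℕ.+ 1
        A : ℕ → Carrier
        A m = fromℕ (i C (2 ℕ.* m)) * -½ ^ (i ℕ.∸ 2 ℕ.* m)
        m<i : ∀ m → m < N → m < i
        m<i m = m<⌊i/2⌋+1⇒m<i i m (s≤s z≤n)
        i<q-1 : i < q-1
        i<q-1 = subst (i <_) (sym q-1≡h+h) (ℕP.<-≤-trans i<h (ℕP.m≤m+n h h))
        regroup : ∀ m → 2 ℕ.* m ≤ i → A m * (fromℕ ((2 ℕ.* m) C m) * -¼ ^ m * -¼ ^ m)
                                      ≡ -¼ ^ i * (fromℕ (i C (2 ℕ.* m)) * two ^ (i ℕ.∸ 2 ℕ.* m) * fromℕ ((2 ℕ.* m) C m))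
        regroup m 2m≤i = begin
          C₁ * -½ ^ d * (C₂ * -¼ ^ m * -¼ ^ m)
            ≡⟨ cong (λ t → C₁ * t ^ d * (C₂ * -¼ ^ m * -¼ ^ m)) -¼*two≡-½ ⟨
          C₁ * (-¼ * two) ^ d * (C₂ * -¼ ^ m * -¼ ^ m)
            ≡⟨ cong (λ t → C₁ * t * (C₂ * -¼ ^ m * -¼ ^ m)) (^-distrib-* -¼ two d) ⟩
          C₁ * (-¼ ^ d * two ^ d) * (C₂ * -¼ ^ m * -¼ ^ m)
            ≡⟨ solve 6 (λ C₁ a t C₂ b c → C₁ :* (a :* t) :* (C₂ :* b :* c) := (a :* (b :* c)) :* (C₁ :* t :* C₂))
                  refl C₁ (-¼ ^ d) (two ^ d) C₂ (-¼ ^ m) (-¼ ^ m) ⟩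
          (-¼ ^ d * (-¼ ^ m * -¼ ^ m)) * (C₁ * two ^ d * C₂)
            ≡⟨ cong (_* (C₁ * two ^ d * C₂)) (^-split -¼ i m 2m≤i) ⟨
          -¼ ^ i * (C₁ * two ^ d * C₂)
            ∎
          where
          d = i ℕ.∸ 2 ℕ.* m
          C₁ = fromℕ (i C (2 ℕ.* m))
          C₂ = fromℕ ((2 ℕ.* m) C m)

    fromℕ[2^n]≡two^n : ∀ n → fromℕ (2 ℕ.^ n) ≡ two ^ n
    fromℕ[2^n]≡two^n zero    = +-identityʳ 1#
    fromℕ[2^n]≡two^n (suc n) = begin
      fromℕ (2 ℕ.* 2 ℕ.^ n)         ≡⟨ fromℕ-* 2 (2 ℕ.^ n) ⟩
      fromℕ 2 * fromℕ (2 ℕ.^ n)     ≡⟨ cong₂ _*_ (sym (fromℕ′≡fromℕ 2)) (fromℕ[2^n]≡two^n n) ⟩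
      two * two ^ n                 ∎

    [2^n]⁻¹≡½^n : ∀ n → fromℕ (2 ℕ.^ n) ⁻¹ ≡ ½ ^ n
    [2^n]⁻¹≡½^n n = ⁻¹-unique (begin
      fromℕ (2 ℕ.^ n) * ½ ^ n    ≡⟨ cong (_* ½ ^ n) (fromℕ[2^n]≡two^n n) ⟩
      two ^ n * ½ ^ n            ≡⟨ ^-distrib-* two ½ n ⟨
      (two * ½) ^ n              ≡⟨ cong (_^ n) two*½≡1 ⟩
      1# ^ n                     ≡⟨ 1^n≡1 n ⟩
      1#                         ∎)

    binomial-h≡innerSum : ∀ ℓ → ℓ < h → fromℕ (h C (h ℕ.∸ ℓ)) ≡ -½ ^ ℓ * innerSum ℓ
    binomial-h≡innerSum ℓ ℓ<h = begin
      fromℕ (h C (h ℕ.∸ ℓ))                                              ≡⟨ binomial-h≡central ℓ ℓ<h ⟩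
      fromℕ ((2 ℕ.* ℓ) C ℓ) * -¼ ^ ℓ                                     ≡⟨ cong (_* -¼ ^ ℓ) (central-binomial-expansion ℓ ℓ<q-1) ⟩
      ∑[ m < N ] (fromℕ (ℓ C (2 ℕ.* m)) * two ^ (ℓ ℕ.∸ 2 ℕ.* m) * fromℕ ((2 ℕ.* m) C m)) * -¼ ^ ℓ
                                                                         ≡⟨ *-comm _ _ ⟩
      -¼ ^ ℓ * ∑[ m < N ] (fromℕ (ℓ C (2 ℕ.* m)) * two ^ (ℓ ℕ.∸ 2 ℕ.* m) * fromℕ ((2 ℕ.* m) C m))
                                                                         ≡⟨ sumTo-* N (-¼ ^ ℓ) _ ⟨
      ∑[ m < N ] (-¼ ^ ℓ * (fromℕ (ℓ C (2 ℕ.* m)) * two ^ (ℓ ℕ.∸ 2 ℕ.* m) * fromℕ ((2 ℕ.* m) C m)))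
                                                                         ≡⟨ sumTo-cong N (λ m m<N → regroup m (m<⌊i/2⌋+1⇒2m≤i ℓ m m<N)) ⟩
      ∑[ m < N ] (-½ ^ ℓ * term m)                                       ≡⟨ sumTo-* N (-½ ^ ℓ) term ⟩
      -½ ^ ℓ * ∑[ m < N ] term m                                         ≡⟨ cong (-½ ^ ℓ *_) (Σ-map-applyUpTo term (λ m → m) N) ⟨
      -½ ^ ℓ * innerSum ℓ                                                ∎
      where
      N = ℓ ℕ./ 2 ℕ.+ 1
      ℓ<q-1 : ℓ < q-1
      ℓ<q-1 = subst (ℓ <_) (sym q-1≡h+h) (ℕP.<-≤-trans ℓ<h (ℕP.m≤m+n h h))
      term : ℕ → Carrier
      term m = (fromℕ 4 ⁻¹) ^ m * fromℕ ((ℓ C (2 ℕ.* m)) ℕ.* ((2 ℕ.* m) C m))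
      regroup : ∀ m → 2 ℕ.* m ≤ ℓ → -¼ ^ ℓ * (fromℕ (ℓ C (2 ℕ.* m)) * two ^ (ℓ ℕ.∸ 2 ℕ.* m) * fromℕ ((2 ℕ.* m) C m)) ≡ -½ ^ ℓ * term m
      regroup m 2m≤ℓ = begin
        -¼ ^ ℓ * (C₁ * two ^ d * C₂)
          ≡⟨ cong (λ t → t ^ ℓ * (C₁ * two ^ d * C₂))
                 (solve 1 (λ w → :- (w :* w) := (:- w) :* w) refl ½) ⟩
        (-½ * ½) ^ ℓ * (C₁ * two ^ d * C₂)
          ≡⟨ cong (_* (C₁ * two ^ d * C₂)) (^-distrib-* -½ ½ ℓ) ⟩
        -½ ^ ℓ * ½ ^ ℓ * (C₁ * two ^ d * C₂)
          ≡⟨ cong (λ t → -½ ^ ℓ * t * (C₁ * two ^ d * C₂)) (^-split ½ ℓ m 2m≤ℓ) ⟩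
        -½ ^ ℓ * (½ ^ d * (½ ^ m * ½ ^ m)) * (C₁ * two ^ d * C₂)
          ≡⟨ solve 7 (λ M a c C₁ b C₂ c′ → M :* (a :* (c :* c′)) :* (C₁ :* b :* C₂)
                       := M :* ((a :* b) :* ((c :* c′) :* (C₁ :* C₂))))
                 refl (-½ ^ ℓ) (½ ^ d) (½ ^ m) C₁ (two ^ d) C₂ (½ ^ m) ⟩
        -½ ^ ℓ * ((½ ^ d * two ^ d) * ((½ ^ m * ½ ^ m) * (C₁ * C₂)))
          ≡⟨ cong₂ (λ u v → -½ ^ ℓ * (u * (v * (C₁ * C₂)))) ½^d*two^d≡1 ½^m*½^m≡¼^m ⟩
        -½ ^ ℓ * (1# * ((fromℕ 4 ⁻¹) ^ m * (C₁ * C₂)))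
          ≡⟨ cong (-½ ^ ℓ *_) (*-identityˡ _) ⟩
        -½ ^ ℓ * ((fromℕ 4 ⁻¹) ^ m * (C₁ * C₂))
          ≡⟨ cong (λ t → -½ ^ ℓ * ((fromℕ 4 ⁻¹) ^ m * t)) (fromℕ-* (ℓ C (2 ℕ.* m)) ((2 ℕ.* m) C m)) ⟨
        -½ ^ ℓ * term m
          ∎
        where
        d = ℓ ℕ.∸ 2 ℕ.* m
        C₁ = fromℕ (ℓ C (2 ℕ.* m))
        C₂ = fromℕ ((2 ℕ.* m) C m)
        ½^d*two^d≡1 : ½ ^ d * two ^ d ≡ 1#
        ½^d*two^d≡1 = trans (sym (^-distrib-* ½ two d)) (trans (cong (_^ d) (trans (*-comm ½ two) two*½≡1)) (1^n≡1 d))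
        ½^m*½^m≡¼^m : ½ ^ m * ½ ^ m ≡ (fromℕ 4 ⁻¹) ^ m
        ½^m*½^m≡¼^m = trans (sym (^-distrib-* ½ ½ m)) (cong (_^ m) (sym (trans ([2^n]⁻¹≡½^n 2) (cong (½ *_) (*-identityʳ ½)))))

    -- The quadratic character and the sum over D

    χ[x]²≡1 : ∀ {x} → x ≢ 0# → χ x * χ x ≡ 1#
    χ[x]²≡1 {x} x≢0 = trans (sym (^-homo-* x h h)) (trans (cong (x ^_) (sym q-1≡h+h)) (fermat x x≢0))

    χ≡±1 : ∀ {x} → x ≢ 0# → χ x ≡ 1# ⊎ χ x ≡ - 1#
    χ≡±1 {x} x≢0 with x*y≡0⇒x≡0⊎y≡0 (χ x - 1#) (χ x + 1#) (begin
      (χ x - 1#) * (χ x + 1#)  ≡⟨ solve 1 (λ c → (c :- con (ℤ.+ 1)) :* (c :+ con (ℤ.+ 1)) := c :* c :- con (ℤ.+ 1)) refl (χ x) ⟩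
      χ x * χ x - 1#           ≡⟨ cong (_- 1#) (χ[x]²≡1 x≢0) ⟩
      1# - 1#                  ≡⟨ -‿inverseʳ 1# ⟩
      0#                       ∎)
    ... | inj₁ χx-1≡0 = inj₁ (x-y≡0⇒x≡y χx-1≡0)
    ... | inj₂ χx+1≡0 = inj₂ (x-y≡0⇒x≡y (trans (cong (χ x +_) (-‿involutive 1#)) χx+1≡0))

    χ0≡0 : χ 0# ≡ 0#
    χ0≡0 = 0^n≡0 h 1≤h

    χ-homo-* : ∀ x y → χ (x * y) ≡ χ x * χ y
    χ-homo-* x y = ^-distrib-* x y h

    χ≢0 : ∀ {x} → x ≢ 0# → χ x ≢ 0#
    χ≢0 = ^-nonzero h

    1+u*u≡two : ∀ {u} → u ≡ 1# ⊎ u ≡ - 1# → 1# + u * u ≡ two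
    1+u*u≡two (inj₁ refl) = cong (1# +_) (*-identityˡ 1#)
    1+u*u≡two (inj₂ refl) = cong (1# +_) (solve 0 (:- con (ℤ.+ 1) :* :- con (ℤ.+ 1) := con (ℤ.+ 1)) refl)

    1+u*v≡0 : ∀ {u v} → u ≡ 1# ⊎ u ≡ - 1# → v ≡ 1# ⊎ v ≡ - 1# → v ≢ u → 1# + u * v ≡ 0#
    1+u*v≡0 (inj₁ refl) (inj₁ refl) v≢u = ⊥-elim (v≢u refl)
    1+u*v≡0 (inj₁ refl) (inj₂ refl) _   = solve 0 (con (ℤ.+ 1) :+ con (ℤ.+ 1) :* :- con (ℤ.+ 1) := con (ℤ.+ 0)) refl
    1+u*v≡0 (inj₂ refl) (inj₁ refl) _   = solve 0 (con (ℤ.+ 1) :+ :- con (ℤ.+ 1) :* con (ℤ.+ 1) := con (ℤ.+ 0)) refl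
    1+u*v≡0 (inj₂ refl) (inj₂ refl) v≢u = ⊥-elim (v≢u refl)

    [4*[-1]^[ℓ+1]]⁻¹ : ∀ ℓ → (fromℕ 4 * (- 1#) ^ (ℓ ℕ.+ 1)) ⁻¹ ≡ ¼ * - (- 1#) ^ ℓ
    [4*[-1]^[ℓ+1]]⁻¹ ℓ = ⁻¹-unique (begin
      fromℕ 4 * (- 1#) ^ (ℓ ℕ.+ 1) * (¼ * - s)      ≡⟨ cong₂ (λ u v → u * v * (¼ * - s)) (fromℕ′≡fromℕ 4) (cong ((- 1#) ^_) (ℕP.+-comm 1 ℓ)) ⟨
      fromℕ′ 4 * (- 1# * s) * (¼ * - s)            ≡⟨ solve 2 (λ w s → con (ℤ.+ 4) :* (:- con (ℤ.+ 1) :* s) :* ((w :* w) :* (:- s))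
                                                                   := ((con (ℤ.+ 2) :* w) :* (con (ℤ.+ 2) :* w)) :* (s :* s)) refl ½ s ⟩
      ((two * ½) * (two * ½)) * (s * s)            ≡⟨ cong₂ (λ u v → (u * u) * v) two*½≡1 ([-1]^ℓ*[-1]^ℓ≡1 ℓ) ⟩
      (1# * 1#) * 1#                               ≡⟨ trans (*-identityʳ _) (*-identityˡ 1#) ⟩
      1#                                           ∎)
      where
      s = (- 1#) ^ ℓ

    module _ (a b : Carrier) (a≢0 : a ≢ 0#) (b≢0 : b ≢ 0#) where

      module _ (k : ℤ) (k′ : ℕ) (1≤k′ : 1 ≤ k′) (x^ᶻk≡x^k′ : ∀ x → x ≢ 0# → x ^ᶻ k ≡ x ^ k′) where

        -- Off {0, -1} the factor (1 + χ a χ x)(1 + χ b χ (x + 1)) / 4 is the indicator of D.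
        weight : Carrier → Carrier
        weight x = ¼ * (x ^ k′ * ((1# + χ a * χ x) * (1# + χ b * χ (x + 1#))))

        select-D≡weight : ∀ x → x ≢ - 1# → select ((χ x ≟ χ a) ×-dec (χ (x + 1#) ≟ χ b)) (x ^ᶻ k) ≡ weight x
        select-D≡weight x x≢-1 with x ≟ 0#
        ... | yes refl with χ 0# ≟ χ a
        ...   | yes χ0≡χa = ⊥-elim (χ≢0 a≢0 (trans (sym χ0≡χa) χ0≡0))
        ...   | no  _     = sym (trans (cong (λ t → ¼ * (t * _)) (0^n≡0 k′ 1≤k′)) (trans (cong (¼ *_) (zeroˡ _)) (zeroʳ ¼)))
        select-D≡weight x x≢-1 | no x≢0 with χ x ≟ χ a | χ (x + 1#) ≟ χ b
        ... | yes χx≡χa | yes χ[x+1]≡χb = sym (begin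
          ¼ * (x ^ k′ * ((1# + χ a * χ x) * (1# + χ b * χ (x + 1#))))
            ≡⟨ cong₂ (λ u v → ¼ * (x ^ k′ * ((1# + χ a * u) * (1# + χ b * v)))) χx≡χa χ[x+1]≡χb ⟩
          ¼ * (x ^ k′ * ((1# + χ a * χ a) * (1# + χ b * χ b)))
            ≡⟨ cong₂ (λ u v → ¼ * (x ^ k′ * (u * v))) (1+u*u≡two (χ≡±1 a≢0)) (1+u*u≡two (χ≡±1 b≢0)) ⟩
          ¼ * (x ^ k′ * (two * two))
            ≡⟨ solve 3 (λ w X t → (w :* w) :* (X :* (t :* t)) := X :* ((t :* w) :* (t :* w))) refl ½ (x ^ k′) two ⟩
          x ^ k′ * ((two * ½) * (two * ½))
            ≡⟨ cong (λ t → x ^ k′ * (t * t)) two*½≡1 ⟩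
          x ^ k′ * (1# * 1#)
            ≡⟨ trans (cong (x ^ k′ *_) (*-identityˡ 1#)) (*-identityʳ _) ⟩
          x ^ k′
            ≡⟨ x^ᶻk≡x^k′ x x≢0 ⟨
          x ^ᶻ k
            ∎)
        ... | yes _ | no χ[x+1]≢χb = sym (begin
          ¼ * (x ^ k′ * ((1# + χ a * χ x) * (1# + χ b * χ (x + 1#))))
            ≡⟨ cong (λ v → ¼ * (x ^ k′ * ((1# + χ a * χ x) * v)))
                    (1+u*v≡0 (χ≡±1 b≢0) (χ≡±1 (x+1≢0 x≢-1)) χ[x+1]≢χb) ⟩
          ¼ * (x ^ k′ * ((1# + χ a * χ x) * 0#))
            ≡⟨ solve 3 (λ w X u → w :* (X :* (u :* con (ℤ.+ 0))) := con (ℤ.+ 0)) refl ¼ (x ^ k′) _ ⟩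
          0#
            ∎)
        ... | no χx≢χa | _ = sym (begin
          ¼ * (x ^ k′ * ((1# + χ a * χ x) * (1# + χ b * χ (x + 1#))))
            ≡⟨ cong (λ u → ¼ * (x ^ k′ * (u * (1# + χ b * χ (x + 1#)))))
                    (1+u*v≡0 (χ≡±1 a≢0) (χ≡±1 x≢0) χx≢χa) ⟩
          ¼ * (x ^ k′ * (0# * (1# + χ b * χ (x + 1#))))
            ≡⟨ solve 3 (λ w X u → w :* (X :* (con (ℤ.+ 0) :* u)) := con (ℤ.+ 0)) refl ¼ (x ^ k′) _ ⟩
          0#
            ∎)

        select-D[-1]≡0 : select ((χ (- 1#) ≟ χ a) ×-dec (χ (- 1# + 1#) ≟ χ b)) ((- 1#) ^ᶻ k) ≡ 0#
        select-D[-1]≡0 with χ (- 1#) ≟ χ a | χ (- 1# + 1#) ≟ χ b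
        ... | _     | yes χ0≡χb = ⊥-elim (χ≢0 b≢0 (trans (sym χ0≡χb) (trans (cong χ -1+1≡0) χ0≡0)))
        ... | yes _ | no _      = refl
        ... | no _  | no _      = refl

        powerSumD≡Σweight : powerSumD a b k ≡ Σ (map weight elements) - weight (- 1#)
        powerSumD≡Σweight = trans (Σ-map-filter P? (_^ᶻ k) elements)
          (Σ-map-except weight (λ x → select (P? x) (x ^ᶻ k)) (- 1#) select-D≡weight select-D[-1]≡0)
          where
          P? = λ x → (χ x ≟ χ a) ×-dec (χ (x + 1#) ≟ χ b)

        Σweight : Σ (map weight elements) ≡ ¼ * (powerSum k′ + (χ a * powerSum (k′ ℕ.+ h)
                    + (χ b * Σ (map (λ x → x ^ k′ * (x + 1#) ^ h) elements)
                       + (χ a * χ b) * Σ (map (λ x → x ^ (k′ ℕ.+ h) * (1# + x) ^ h) elements))))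
        Σweight = begin
          Σ (map weight elements)
            ≡⟨ Σ-map-* ¼ _ elements ⟩
          ¼ * Σ (map (λ x → x ^ k′ * I x) elements)
            ≡⟨ cong (¼ *_) (Σ-map-cong elements expand) ⟩
          ¼ * Σ (map (λ x → f₁ x + (χ a * f₂ x + (χ b * f₃ x + (χ a * χ b) * f₄ x))) elements)
            ≡⟨ cong (¼ *_) (Σ-map-+ f₁ _ elements) ⟩
          ¼ * (powerSum k′ + Σ (map (λ x → χ a * f₂ x + (χ b * f₃ x + (χ a * χ b) * f₄ x)) elements))
            ≡⟨ cong (λ t → ¼ * (powerSum k′ + t)) (Σ-map-+ (λ x → χ a * f₂ x) _ elements) ⟩
          ¼ * (powerSum k′ + (Σ (map (λ x → χ a * f₂ x) elements) + Σ (map (λ x → χ b * f₃ x + (χ a * χ b) * f₄ x) elements)))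
            ≡⟨ cong (λ t → ¼ * (powerSum k′ + (Σ (map (λ x → χ a * f₂ x) elements) + t)))
                    (Σ-map-+ (λ x → χ b * f₃ x) (λ x → (χ a * χ b) * f₄ x) elements) ⟩
          ¼ * (powerSum k′ + (Σ (map (λ x → χ a * f₂ x) elements)
                              + (Σ (map (λ x → χ b * f₃ x) elements) + Σ (map (λ x → (χ a * χ b) * f₄ x) elements))))
            ≡⟨ cong₂ (λ u v → ¼ * (powerSum k′ + (u + v))) (Σ-map-* (χ a) f₂ elements)
                     (cong₂ _+_ (Σ-map-* (χ b) f₃ elements) (Σ-map-* (χ a * χ b) f₄ elements)) ⟩
          ¼ * (powerSum k′ + (χ a * powerSum (k′ ℕ.+ h) + (χ b * Σ (map f₃ elements) + (χ a * χ b) * Σ (map f₄ elements))))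
            ∎
          where
          I : Carrier → Carrier
          I x = (1# + χ a * χ x) * (1# + χ b * χ (x + 1#))
          f₁ f₂ f₃ f₄ : Carrier → Carrier
          f₁ x = x ^ k′
          f₂ x = x ^ (k′ ℕ.+ h)
          f₃ x = x ^ k′ * (x + 1#) ^ h
          f₄ x = x ^ (k′ ℕ.+ h) * (1# + x) ^ h
          expand : ∀ x → x ^ k′ * I x ≡ f₁ x + (χ a * f₂ x + (χ b * f₃ x + (χ a * χ b) * f₄ x))
          expand x = begin
            x ^ k′ * ((1# + χ a * x ^ h) * (1# + χ b * (x + 1#) ^ h))
              ≡⟨ solve 5 (λ X A H B Y → X :* ((con (ℤ.+ 1) :+ A :* H) :* (con (ℤ.+ 1) :+ B :* Y))
                                      := X :+ (A :* (X :* H) :+ (B :* (X :* Y) :+ (A :* B) :* ((X :* H) :* Y))))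
                   refl (x ^ k′) (χ a) (x ^ h) (χ b) ((x + 1#) ^ h) ⟩
            x ^ k′ + (χ a * (x ^ k′ * x ^ h) + (χ b * f₃ x + (χ a * χ b) * ((x ^ k′ * x ^ h) * (x + 1#) ^ h)))
              ≡⟨ cong₂ (λ u v → x ^ k′ + (χ a * u + (χ b * f₃ x + (χ a * χ b) * (u * v ^ h)))) (sym (^-homo-* x k′ h)) (+-comm x 1#) ⟩
            f₁ x + (χ a * f₂ x + (χ b * f₃ x + (χ a * χ b) * f₄ x)) ∎

        weight[-1] : weight (- 1#) ≡ ¼ * ((- 1#) ^ k′ * (1# + χ (- a)))
        weight[-1] = cong (λ t → ¼ * ((- 1#) ^ k′ * t)) (begin
          (1# + χ a * χ (- 1#)) * (1# + χ b * χ (- 1# + 1#))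
            ≡⟨ cong (λ t → (1# + χ a * χ (- 1#)) * (1# + χ b * t)) (trans (cong χ -1+1≡0) χ0≡0) ⟩
          (1# + χ a * χ (- 1#)) * (1# + χ b * 0#)
            ≡⟨ solve 2 (λ u B → u :* (con (ℤ.+ 1) :+ B :* con (ℤ.+ 0)) := u) refl (1# + χ a * χ (- 1#)) (χ b) ⟩
          1# + χ a * χ (- 1#)
            ≡⟨ cong (1# +_) (χ-homo-* a (- 1#)) ⟨
          1# + χ (a * - 1#)
            ≡⟨ cong (λ t → 1# + χ t) (solve 1 (λ a → a :* (:- con (ℤ.+ 1)) := :- a) refl a) ⟩
          1# + χ (- a)
            ∎)

        powerSumD-expansion : powerSumD a b k ≡ ¼ * (powerSum k′ + (χ a * powerSum (k′ ℕ.+ h)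
                                                     + (χ b * Σ (map (λ x → x ^ k′ * (x + 1#) ^ h) elements)
                                                        + (χ a * χ b) * Σ (map (λ x → x ^ (k′ ℕ.+ h) * (1# + x) ^ h) elements))))
                                                 - ¼ * ((- 1#) ^ k′ * (1# + χ (- a)))
        powerSumD-expansion = trans powerSumD≡Σweight (cong₂ _-_ Σweight weight[-1])

      powerSumD-ε=1 : ∀ k ℓ → 1 ≤ ℓ → ℓ < h → (∀ x → x ≢ 0# → x ^ᶻ k ≡ x ^ ℓ) →
        powerSumD a b k ≡ ¼ * ((χ a * χ b) * - fromℕ (h C (h ℕ.∸ ℓ))) - ¼ * ((- 1#) ^ ℓ * (1# + χ (- a)))
      powerSumD-ε=1 k ℓ 1≤ℓ ℓ<h x^ᶻk≡x^ℓ = begin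
        powerSumD a b k
          ≡⟨ powerSumD-expansion k ℓ 1≤ℓ x^ᶻk≡x^ℓ ⟩
        ¼ * (powerSum ℓ + (χ a * powerSum (ℓ ℕ.+ h) + (χ b * S₃ + (χ a * χ b) * S₄))) - R
          ≡⟨ cong₂ (λ u v → ¼ * (u + (χ a * v + (χ b * S₃ + (χ a * χ b) * S₄))) - R) (powerSum-<h+h ℓ<2h) (powerSum-<h+h ℓ+h<2h) ⟩
        ¼ * (0# + (χ a * 0# + (χ b * S₃ + (χ a * χ b) * S₄))) - R
          ≡⟨ cong₂ (λ u v → ¼ * (0# + (χ a * 0# + (χ b * u + (χ a * χ b) * v))) - R) S₃≡0 (Σ-x^[ℓ+h][1+x]^h ℓ ℓ<h) ⟩
        ¼ * (0# + (χ a * 0# + (χ b * 0# + (χ a * χ b) * - K))) - R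
          ≡⟨ cong (λ t → ¼ * t - R) (solve 3 (λ A B X → z :+ (A :* z :+ (B :* z :+ (A :* B) :* X)) := (A :* B) :* X) refl (χ a) (χ b) (- K)) ⟩
        ¼ * ((χ a * χ b) * - K) - R
          ∎
        where
        z : ∀ {n} → Polynomial n
        z = con (ℤ.+ 0)
        K = fromℕ (h C (h ℕ.∸ ℓ))
        R = ¼ * ((- 1#) ^ ℓ * (1# + χ (- a)))
        S₃ = Σ (map (λ x → x ^ ℓ * (x + 1#) ^ h) elements)
        S₄ = Σ (map (λ x → x ^ (ℓ ℕ.+ h) * (1# + x) ^ h) elements)
        ℓ<2h : ℓ < h ℕ.+ h
        ℓ<2h = ℕP.<-≤-trans ℓ<h (ℕP.m≤m+n h h)
        ℓ+h<2h : ℓ ℕ.+ h < h ℕ.+ h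
        ℓ+h<2h = ℕP.+-monoˡ-< h ℓ<h
        S₃≡0 : S₃ ≡ 0#
        S₃≡0 = trans (Σ-x^a[x+1]^h ℓ) (sumTo-powerSum-0-h (suc h) (λ j → fromℕ (h C j)) (λ j → ℓ ℕ.+ (h ℕ.∸ j))
          (λ j _ → let ℓ+[h∸j]<2h = ℕP.≤-<-trans (ℕP.+-monoʳ-≤ ℓ (ℕP.m∸n≤m h j)) ℓ+h<2h
                   in ℕP.<-≤-trans ℓ+[h∸j]<2h (ℕP.m≤m+n _ _) , ℕP.<⇒≢ ℓ+[h∸j]<2h))

      powerSumD-ε=-1 : ∀ k ℓ → 1 ≤ ℓ → ℓ < h → (∀ x → x ≢ 0# → x ^ᶻ k ≡ x ^ (h ℕ.+ (h ℕ.∸ ℓ))) →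
        powerSumD a b k ≡ ¼ * (χ b * - fromℕ (h C (h ℕ.∸ ℓ))) - ¼ * ((- 1#) ^ ℓ * (1# + χ (- a)))
      powerSumD-ε=-1 k ℓ 1≤ℓ ℓ<h x^ᶻk≡x^k′ = begin
        powerSumD a b k
          ≡⟨ powerSumD-expansion k k′ 1≤k′ x^ᶻk≡x^k′ ⟩
        ¼ * (powerSum k′ + (χ a * powerSum (k′ ℕ.+ h) + (χ b * S₃ + (χ a * χ b) * S₄))) - ¼ * ((- 1#) ^ k′ * X)
          ≡⟨ cong₂ (λ u v → ¼ * (u + (χ a * v + (χ b * S₃ + (χ a * χ b) * S₄))) - ¼ * ((- 1#) ^ k′ * X))
                   (powerSum-<h+h (ℕP.+-monoʳ-< h e<h)) powerSum[k′+h]≡0 ⟩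
        ¼ * (0# + (χ a * 0# + (χ b * S₃ + (χ a * χ b) * S₄))) - ¼ * ((- 1#) ^ k′ * X)
          ≡⟨ cong₂ (λ u v → ¼ * (0# + (χ a * 0# + (χ b * u + (χ a * χ b) * v))) - ¼ * ((- 1#) ^ k′ * X)) S₃≡-K S₄≡0 ⟩
        ¼ * (0# + (χ a * 0# + (χ b * - K + (χ a * χ b) * 0#))) - ¼ * ((- 1#) ^ k′ * X)
          ≡⟨ cong₂ (λ t s → ¼ * t - ¼ * (s * X))
                   (solve 3 (λ A B Y → z :+ (A :* z :+ (B :* Y :+ (A :* B) :* z)) := B :* Y) refl (χ a) (χ b) (- K))
                   [-1]^k′≡[-1]^ℓ ⟩
        ¼ * (χ b * - K) - ¼ * ((- 1#) ^ ℓ * X)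
          ∎
        where
        z : ∀ {n} → Polynomial n
        z = con (ℤ.+ 0)
        e = h ℕ.∸ ℓ
        k′ = h ℕ.+ e
        K = fromℕ (h C e)
        X = 1# + χ (- a)
        S₃ = Σ (map (λ x → x ^ k′ * (x + 1#) ^ h) elements)
        S₄ = Σ (map (λ x → x ^ (k′ ℕ.+ h) * (1# + x) ^ h) elements)
        1≤e : 1 ≤ e
        1≤e = ℕP.m<n⇒0<n∸m ℓ<h
        e<h : e < h
        e<h = ℕP.∸-monoʳ-< 1≤ℓ (ℕP.<⇒≤ ℓ<h)
        1≤k′ : 1 ≤ k′
        1≤k′ = ℕP.≤-trans 1≤e (ℕP.m≤n+m e h)
        powerSum[k′+h]≡0 : powerSum (k′ ℕ.+ h) ≡ 0#
        powerSum[k′+h]≡0 = powerSum-0-h (k′ ℕ.+ h)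
          (subst (_< (h ℕ.+ h) ℕ.+ (h ℕ.+ h)) (ℕP.+-identityʳ (k′ ℕ.+ h)) (h+e+h+j<4h {h} {e} e<h z≤n))
          (ℕP.>⇒≢ (subst (h ℕ.+ h <_) (ℕP.+-identityʳ (k′ ℕ.+ h)) (h+h<h+e+h+j {h} {e} 1≤e)))
        S₃≡-K : S₃ ≡ - K
        S₃≡-K = trans (Σ-x^a[x+1]^h k′) (sumTo-powerSum-single-h (suc h) (λ j → fromℕ (h C j)) (λ j → k′ ℕ.+ (h ℕ.∸ j)) e
          (s≤s (ℕP.m∸n≤m h ℓ)) (h+e+[h∸e]≡h+h (ℕP.m∸n≤m h ℓ))
          (λ j j<1+h j≢e → h+e+[h∸j]<4h {h} {e} {j} e<h , j≢e ∘ h+e+[h∸j]≡h+h⇒j≡e (ℕP.≤-pred j<1+h) (ℕP.m∸n≤m h ℓ)))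
        S₄≡0 : S₄ ≡ 0#
        S₄≡0 = trans (Σ-x^a[1+x]^h (k′ ℕ.+ h)) (sumTo-powerSum-0-h (suc h) (λ j → fromℕ (h C j)) (λ j → k′ ℕ.+ h ℕ.+ j)
          (λ j j<1+h → h+e+h+j<4h {h} {e} e<h (ℕP.≤-pred j<1+h) , ℕP.>⇒≢ (h+h<h+e+h+j {h} {e} {j} 1≤e)))
        [-1]^k′≡[-1]^ℓ : (- 1#) ^ k′ ≡ (- 1#) ^ ℓ
        [-1]^k′≡[-1]^ℓ = begin
          (- 1#) ^ k′                            ≡⟨ *-identityʳ _ ⟨
          (- 1#) ^ k′ * 1#                       ≡⟨ cong ((- 1#) ^ k′ *_) ([-1]^ℓ*[-1]^ℓ≡1 ℓ) ⟨
          (- 1#) ^ k′ * (s * s)                  ≡⟨ *-assoc _ _ _ ⟨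
          ((- 1#) ^ k′ * s) * s                  ≡⟨ cong (_* s) (^-homo-* (- 1#) k′ ℓ) ⟨
          (- 1#) ^ (k′ ℕ.+ ℓ) * s                ≡⟨ cong (λ n → (- 1#) ^ n * s) k′+ℓ≡q-1 ⟩
          (- 1#) ^ q-1 * s                       ≡⟨ cong (_* s) (fermat (- 1#) -1≢0) ⟩
          1# * s                                 ≡⟨ *-identityˡ s ⟩
          s                                      ∎
          where
          s = (- 1#) ^ ℓ
          k′+ℓ≡q-1 : k′ ℕ.+ ℓ ≡ q-1
          k′+ℓ≡q-1 = trans (ℕP.+-assoc h e ℓ) (trans (cong (h ℕ.+_) (ℕP.m∸n+n≡m (ℕP.<⇒≤ ℓ<h))) (sym q-1≡h+h))

      binomial-h-form≡rhs : ∀ ε ℓ → ℓ < h →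
        ¼ * (χ (cOf ε a b) * - fromℕ (h C (h ℕ.∸ ℓ))) - ¼ * ((- 1#) ^ ℓ * (1# + χ (- a))) ≡ rhs a b ε ℓ
      binomial-h-form≡rhs ε ℓ ℓ<h = begin
        ¼ * (c * - fromℕ (h C (h ℕ.∸ ℓ))) - ¼ * (s * X)        ≡⟨ cong (λ t → ¼ * (c * - t) - ¼ * (s * X)) (binomial-h≡innerSum ℓ ℓ<h) ⟩
        ¼ * (c * - (-½ ^ ℓ * innerSum ℓ)) - ¼ * (s * X)       ≡⟨ cong (λ t → ¼ * (c * - (t * innerSum ℓ)) - ¼ * (s * X)) -½^ℓ≡s*½^ℓ ⟩
        ¼ * (c * - (s * ½ ^ ℓ * innerSum ℓ)) - ¼ * (s * X)    ≡⟨ solve 6 (λ w s c v I X → (w :* w) :* (c :* (:- (s :* v :* I))) :- (w :* w) :* (s :* X)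
                                                                              := (X :+ v :* c :* I) :* ((w :* w) :* (:- s)))
                                                                   refl ½ s c (½ ^ ℓ) (innerSum ℓ) X ⟩
        (X + ½ ^ ℓ * c * innerSum ℓ) * (¼ * - s)              ≡⟨ cong₂ (λ u v → (X + u ^ ℓ * c * innerSum ℓ) * v)
                                                                   (cong _⁻¹ (sym (fromℕ′≡fromℕ 2))) ([4*[-1]^[ℓ+1]]⁻¹ ℓ) ⟨
        rhs a b ε ℓ                                           ∎
        where
        c = χ (cOf ε a b)
        s = (- 1#) ^ ℓ
        X = 1# + χ (- a)
        -½^ℓ≡s*½^ℓ : -½ ^ ℓ ≡ s * ½ ^ ℓ
        -½^ℓ≡s*½^ℓ = trans (cong (_^ ℓ) (solve 1 (λ w → :- w := (:- con (ℤ.+ 1)) :* w) refl ½)) (^-distrib-* (- 1#) ½ ℓ)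

      main-formula : ∀ k ℓ ε → ℤ.+ q-1 ∣ (k ℤ.- ε ℤ.* ℤ.+ ℓ) → ε ≡ ℤ.1ℤ ⊎ ε ≡ ℤ.-1ℤ → 0 < ℓ → ℓ < h →
                     powerSumD a b k ≡ rhs a b ε ℓ
      main-formula k ℓ .ℤ.1ℤ q-1∣k-ℓ (inj₁ refl) 0<ℓ ℓ<h = begin
        powerSumD a b k
          ≡⟨ powerSumD-ε=1 k ℓ 0<ℓ ℓ<h x^ᶻk≡x^ℓ ⟩
        ¼ * ((χ a * χ b) * - K) - ¼ * ((- 1#) ^ ℓ * (1# + χ (- a)))
          ≡⟨ cong (λ t → ¼ * (t * - K) - ¼ * ((- 1#) ^ ℓ * (1# + χ (- a)))) (χ-homo-* a b) ⟨
        ¼ * (χ (a * b) * - K) - ¼ * ((- 1#) ^ ℓ * (1# + χ (- a)))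
          ≡⟨ binomial-h-form≡rhs ℤ.1ℤ ℓ ℓ<h ⟩
        rhs a b ℤ.1ℤ ℓ
          ∎
        where
        K = fromℕ (h C (h ℕ.∸ ℓ))
        x^ᶻk≡x^ℓ : ∀ x → x ≢ 0# → x ^ᶻ k ≡ x ^ ℓ
        x^ᶻk≡x^ℓ x x≢0 = ^ᶻ-mod-q-1 x≢0 k ℓ (subst (λ t → ℤ.+ q-1 ∣ (k ℤ.- t)) (ℤP.*-identityˡ (ℤ.+ ℓ)) q-1∣k-ℓ)
      main-formula k ℓ .ℤ.-1ℤ q-1∣k+ℓ (inj₂ refl) 0<ℓ ℓ<h =
        trans (powerSumD-ε=-1 k ℓ 0<ℓ ℓ<h x^ᶻk≡x^[2h-ℓ]) (binomial-h-form≡rhs ℤ.-1ℤ ℓ ℓ<h)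
        where
        q-1∸ℓ≡h+[h∸ℓ] : ℤ.+ q-1 ℤ.- ℤ.+ ℓ ≡ ℤ.+ (h ℕ.+ (h ℕ.∸ ℓ))
        q-1∸ℓ≡h+[h∸ℓ] = begin
          ℤ.+ q-1 ℤ.- ℤ.+ ℓ              ≡⟨ ℤP.m-n≡m⊖n q-1 ℓ ⟩
          q-1 ℤ.⊖ ℓ                      ≡⟨ ℤP.⊖-≥ (subst (ℓ ≤_) (sym q-1≡h+h) (ℕP.≤-trans (ℕP.<⇒≤ ℓ<h) (ℕP.m≤m+n h h))) ⟩
          ℤ.+ (q-1 ℕ.∸ ℓ)                ≡⟨ cong (λ n → ℤ.+ (n ℕ.∸ ℓ)) q-1≡h+h ⟩
          ℤ.+ (h ℕ.+ h ℕ.∸ ℓ)            ≡⟨ cong ℤ.+_ (ℕP.+-∸-assoc h (ℕP.<⇒≤ ℓ<h)) ⟩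
          ℤ.+ (h ℕ.+ (h ℕ.∸ ℓ))          ∎
        q-1∣k-[2h-ℓ] : ℤ.+ q-1 SD.∣ (k ℤ.- ℤ.+ (h ℕ.+ (h ℕ.∸ ℓ)))
        q-1∣k-[2h-ℓ] = subst (ℤ.+ q-1 SD.∣_)
          (trans (ℤSolver.solve 3 (λ k n l → (k ℤSolver.:- (ℤSolver.con ℤ.-1ℤ ℤSolver.:* l)) ℤSolver.:- n
                                              ℤSolver.:= k ℤSolver.:- (n ℤSolver.:- l)) refl k (ℤ.+ q-1) (ℤ.+ ℓ))
                 (cong (λ t → k ℤ.- t) q-1∸ℓ≡h+[h∸ℓ]))
          (SD.∣m∣n⇒∣m-n (SD.∣ᵤ⇒∣ {ℤ.+ q-1} {k ℤ.- ℤ.-1ℤ ℤ.* ℤ.+ ℓ} q-1∣k+ℓ) SD.∣-refl)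
        x^ᶻk≡x^[2h-ℓ] : ∀ x → x ≢ 0# → x ^ᶻ k ≡ x ^ (h ℕ.+ (h ℕ.∸ ℓ))
        x^ᶻk≡x^[2h-ℓ] x x≢0 = ^ᶻ-mod-q-1 x≢0 k (h ℕ.+ (h ℕ.∸ ℓ)) (SD.∣⇒∣ᵤ q-1∣k-[2h-ℓ])

      rhs[ℓ=1] : rhs a b ℤ.1ℤ 1 ≡ (1# + χ (- a)) * (fromℕ 4 ⁻¹) + χ (a * b) * (fromℕ 8 ⁻¹)
      rhs[ℓ=1] = begin
        rhs a b ℤ.1ℤ 1
          ≡⟨ cong₂ (λ u v → (1# + X + u ^ 1 * A * innerSum 1) * v) (cong _⁻¹ (sym (fromℕ′≡fromℕ 2))) ([4*[-1]^[ℓ+1]]⁻¹ 1) ⟩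
        (1# + X + ½ ^ 1 * A * innerSum 1) * (¼ * - (- 1#) ^ 1)
          ≡⟨ solve 3 (λ w X A → (o :+ X :+ (w :* o) :* A :* (o :* (o :+ z) :+ z)) :* ((w :* w) :* (:- (:- o :* o)))
                                := (o :+ X) :* (w :* (w :* o)) :+ A :* (w :* (w :* (w :* o)))) refl ½ X A ⟩
        (1# + X) * ½ ^ 2 + A * ½ ^ 3
          ≡⟨ cong₂ (λ u v → (1# + X) * u + A * v) ([2^n]⁻¹≡½^n 2) ([2^n]⁻¹≡½^n 3) ⟨
        (1# + X) * (fromℕ 4 ⁻¹) + A * (fromℕ 8 ⁻¹)
          ∎
        where
        X = χ (- a)
        A = χ (a * b)
        o z : ∀ {n} → Polynomial n
        o = con (ℤ.+ 1)
        z = con (ℤ.+ 0)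

      -- The two sides agree as polynomials in ½ only up to a multiple of 1 - 2·½.
      rhs[ℓ=2] : rhs a b ℤ.1ℤ 2 ≡ (- 1# - χ (- a)) * (fromℕ 4 ⁻¹) - fromℕ 3 * (χ (a * b) * (fromℕ 32 ⁻¹))
      rhs[ℓ=2] = begin
        rhs a b ℤ.1ℤ 2
          ≡⟨ cong₂ (λ u v → (1# + X + u ^ 2 * A * innerSum 2) * v) (cong _⁻¹ (sym (fromℕ′≡fromℕ 2))) ([4*[-1]^[ℓ+1]]⁻¹ 2) ⟩
        (1# + X + ½ ^ 2 * A * innerSum 2) * (¼ * - (- 1#) ^ 2)
          ≡⟨ cong (λ u → (1# + X + ½ ^ 2 * A * (1# * fromℕ 1 + ((u * 1#) * fromℕ 2 + 0#))) * (¼ * - (- 1#) ^ 2)) ([2^n]⁻¹≡½^n 2) ⟩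
        (1# + X + ½ ^ 2 * A * (1# * fromℕ 1 + ((½ ^ 2 * 1#) * fromℕ 2 + 0#))) * (¼ * - (- 1#) ^ 2)
          ≡⟨ solve 3 (λ w X A →
               (o :+ X :+ (w :* (w :* o)) :* A :* (o :* (o :+ z) :+ (((w :* (w :* o)) :* o) :* (o :+ (o :+ z)) :+ z)))
                 :* ((w :* w) :* (:- (:- o :* (:- o :* o))))
               := ((:- o :- X) :* (w :* (w :* o)) :- (o :+ (o :+ (o :+ z))) :* (A :* (w :* (w :* (w :* (w :* (w :* o)))))))
                  :+ (:- (A :* (w :* w :* w :* w) :* (o :- w))) :* (o :- con (ℤ.+ 2) :* w)) refl ½ X A ⟩
        R + E * (1# - two * ½)
          ≡⟨ cong (λ t → R + E * (1# - t)) two*½≡1 ⟩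
        R + E * (1# - 1#)
          ≡⟨ cong (λ t → R + E * t) (-‿inverseʳ 1#) ⟩
        R + E * 0#
          ≡⟨ trans (cong (R +_) (zeroʳ E)) (+-identityʳ R) ⟩
        R
          ≡⟨ cong₂ (λ u v → (- 1# - X) * u - fromℕ 3 * (A * v)) ([2^n]⁻¹≡½^n 2) ([2^n]⁻¹≡½^n 5) ⟨
        (- 1# - X) * (fromℕ 4 ⁻¹) - fromℕ 3 * (A * (fromℕ 32 ⁻¹))
          ∎
        where
        X = χ (- a)
        A = χ (a * b)
        o z : ∀ {n} → Polynomial n
        o = con (ℤ.+ 1)
        z = con (ℤ.+ 0)
        R = (- 1# - X) * ½ ^ 2 - fromℕ 3 * (A * ½ ^ 5)
        E = - (A * (½ * ½ * ½ * ½) * (1# - ½))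

open import Data.Integer using (+_)

theorem1p1 : (F : FiniteField) → let open FiniteField F in
    order ℕ.% 2 ≡ 1 →
    (a b : Carrier) → a ≢ 0# → b ≢ 0# →
    ((k : ℤ) (ℓ : ℕ) (ε : ℤ) →
      ¬ (+ ((order ℕ.∸ 1) ℕ./ 2) ∣ k) →
      (+ (order ℕ.∸ 1) ∣ (k ℤ.- ε ℤ.* + ℓ)) →
      (ε ≡ ℤ.1ℤ ⊎ ε ≡ ℤ.-1ℤ) →
      0 < ℓ → ℓ < (order ℕ.∸ 1) ℕ./ 2 →
      powerSumD a b k ≡ rhs a b ε ℓ)
    × (3 < order →
      powerSumD a b (+ 1) ≡ (1# + χ (- a)) * (fromℕ 4 ⁻¹) + χ (a * b) * (fromℕ 8 ⁻¹))
    × (5 < order →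
      powerSumD a b (+ 2) ≡ (- 1# - χ (- a)) * (fromℕ 4 ⁻¹) - fromℕ 3 * (χ (a * b) * (fromℕ 32 ⁻¹)))
theorem1p1 F q-odd a b a≢0 b≢0 =
  (λ k ℓ ε _ q-1∣k-εℓ → main-formula F q-odd a b a≢0 b≢0 k ℓ ε (subst (λ n → + n ∣ (k ℤ.- ε ℤ.* + ℓ)) order-1≡q-1 q-1∣k-εℓ)) ,
  (λ 3<q → trans (main-formula F q-odd a b a≢0 b≢0 (+ 1) 1 ℤ.1ℤ (ℕDiv.divides 0 refl) (inj₁ refl) (s≤s z≤n) (h-bound 3<q))
                 (rhs[ℓ=1] F q-odd a b a≢0 b≢0)) ,
  (λ 5<q → trans (main-formula F q-odd a b a≢0 b≢0 (+ 2) 2 ℤ.1ℤ (ℕDiv.divides 0 refl) (inj₁ refl) (s≤s z≤n) (h-bound 5<q))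
                 (rhs[ℓ=2] F q-odd a b a≢0 b≢0))
  where
  open FiniteField F using (order)
  order-1≡q-1 : order ℕ.∸ 1 ≡ q-1 F
  order-1≡q-1 = cong (ℕ._∸ 1) (order≡1+q-1 F)
  h-bound : ∀ {m} → suc (m ℕ.+ m) < order → m < h F q-odd
  h-bound {m} m<q = m+m<h+h⇒m<h (ℕP.≤-pred (subst (suc (m ℕ.+ m) <_)
    (trans (order≡1+q-1 F) (cong suc (q-1≡h+h F q-odd))) m<q))
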